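{- Let $d \ge 3$ and let $\preceq$ be any partial order on the vertex set of the halfcube $H_d = \operatorname{conv}\{\mathbf{p} \in \{0,1\}^d : p_1+\cdots+p_d \text{ even}\}$ such that every nonempty face of $H_d$ has a unique minimal vertex. Then the simplices of the pulling triangulation $\mathrm{Pull}_\preceq(H_d)$ are in bijection with pairs $(\tau, B)$, where $\tau$ is a partial permutation of $[d]$ and $B \subseteq [d] \setminus \tau$ is a subset of odd cardinality with $|B| \ne 1$.
   Context: A partial permutation of $[d]$ is a (possibly empty) sequence $\tau = i_1 i_2 \cdots i_k$ of pairwise distinct elements of $[d]$; $[d]\setminus\tau$ denotes $[d]\setminus\{i_1,\dots,i_k\}$. Pulling triangulations: for a polytope $P$ and a partial order $\preceq$ on its vertices such that every nonempty face $F$ has a unique minimal vertex $\mathbf{v}_F$, $\mathrm{Pull}_\preceq(P) = \{P\}$ if $P$ is a simplex, and otherwise $\mathrm{Pull}_\preceq(P) = \bigcup_F \{ \operatorname{conv}(Q \cup \{\mathbf{v}_P\}) : Q \in \mathrm{Pull}_\preceq(F)\}$, the union over all facets $F$ of $P$ not containing $\mathbf{v}_P$ (recursion applied to facets with the restricted order). -}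

module Defs where

open import Data.Nat using (ℕ; zero; suc; _%_; _≤_)
open import Data.Bool using (Bool; true; false; if_then_else_)
open import Data.Integer using (ℤ; +_) renaming (_+_ to _+ℤ_; _*_ to _*ℤ_; _≤_ to _≤ℤ_)
open import Data.Vec using (Vec; []; _∷_; lookup)
open import Data.List using (List; []; _∷_; _++_; map; foldr)
open import Data.Fin using (Fin)
open import Data.Fin.Subset using (Subset; _∉_; ∣_∣)
open import Data.List.Membership.Propositional using (_∈_)
open import Data.List.Relation.Unary.Unique.Propositional using (Unique)
open import Data.Product using (Σ; ∃; _×_; _,_)
open import Data.Sum using (_⊎_)
open import Relation.Binary.PropositionalEquality using (_≡_)
open import Relation.Nullary using (¬_)

-- Points of {0,1}^d are encoded as Vec Bool d (true = coordinate 1).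

Pt : ℕ → Set
Pt d = Vec Bool d

weight : ∀ {d} → Pt d → ℕ
weight [] = 0
weight (true ∷ v) = suc (weight v)
weight (false ∷ v) = weight v

HVert : ∀ {d} → Pt d → Set
HVert v = weight v % 2 ≡ 0

VSet : ℕ → Set₁
VSet d = Pt d → Set

Halfcube : (d : ℕ) → VSet d
Halfcube d = HVert

_⊆_ : ∀ {d} → VSet d → VSet d → Set
A ⊆ B = ∀ v → A v → B v

_≈_ : ∀ {d} → VSet d → VSet d → Set
A ≈ B = A ⊆ B × B ⊆ A

_∪₁_ : ∀ {d} → VSet d → Pt d → VSet d
(A ∪₁ v) w = A w ⊎ w ≡ v

coord : Bool → ℤ
coord b = if b then + 1 else + 0

dot : ∀ {d} → Vec ℤ d → Pt d → ℤ
dot [] [] = + 0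
dot (c ∷ cs) (b ∷ v) = c *ℤ coord b +ℤ dot cs v

-- F is a face iff F = {v ∈ vert(H_d) : c·v = m} for some integral
-- functional c and m with c·v ≤ m for all vertices (includes the empty
-- face and H_d itself; integral normals suffice for a lattice polytope).

IsFace : ∀ {d} → VSet d → Set
IsFace {d} F = Σ (Vec ℤ d) λ c → Σ ℤ λ m →
  (∀ v → HVert v → dot c v ≤ℤ m) ×
  (∀ v → (F v → HVert v × dot c v ≡ m) × (HVert v × dot c v ≡ m → F v))

Nonempty : ∀ {d} → VSet d → Set
Nonempty F = ∃ λ v → F v

-- G is a facet of the face F: a maximal proper face of F
-- (faces of a face F of H_d are exactly the faces of H_d contained in F)
IsFacetOf : ∀ {d} → VSet d → VSet d → Set₁
IsFacetOf {d} G F = IsFace G × G ⊆ F × (∃ λ v → F v × ¬ G v) ×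
  ((K : VSet d) → IsFace K → G ⊆ K → K ⊆ F → K ≈ G ⊎ K ≈ F)

-- Affine independence (over ℚ; equivalently over ℤ by clearing
-- denominators) of a set of points, using sums over all of {0,1}^d.

allPts : (d : ℕ) → List (Pt d)
allPts zero = [] ∷ []
allPts (suc d) = map (true ∷_) (allPts d) ++ map (false ∷_) (allPts d)

sumAll : ∀ {d} → (Pt d → ℤ) → ℤ
sumAll {d} f = foldr (λ v acc → f v +ℤ acc) (+ 0) (allPts d)

AffinelyIndependent : ∀ {d} → VSet d → Set
AffinelyIndependent {d} F = (λ′ : Pt d → ℤ) →
  (∀ v → ¬ F v → λ′ v ≡ + 0) →
  sumAll λ′ ≡ + 0 →
  (∀ (i : Fin d) → sumAll (λ v → λ′ v *ℤ coord (lookup v i)) ≡ + 0) →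
  ∀ v → λ′ v ≡ + 0

-- conv(F) is a simplex iff its vertex set is affinely independent
IsSimplex : ∀ {d} → VSet d → Set
IsSimplex = AffinelyIndependent

module _ {d : ℕ} (_⪯_ : Pt d → Pt d → Set) where

  IsVertexOrder : Set
  IsVertexOrder =
    (∀ v → HVert v → v ⪯ v) ×
    (∀ v w → HVert v → HVert w → v ⪯ w → w ⪯ v → v ≡ w) ×
    (∀ u v w → HVert u → HVert v → HVert w → u ⪯ v → v ⪯ w → u ⪯ w)

  Minimal : VSet d → Pt d → Set
  Minimal F v = F v × (∀ w → F w → w ⪯ v → w ≡ v)

  UniqueMinima : Set₁
  UniqueMinima = (F : VSet d) → IsFace F → Nonempty F →
    Σ (Pt d) λ v → Minimal F v × (∀ w → Minimal F w → w ≡ v)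

  -- Pull F S : the simplex with vertex set S belongs to Pull_⪯(conv F)
  data Pull : VSet d → VSet d → Set₁ where
    simplex : ∀ {F S} → IsSimplex F → S ≈ F → Pull F S
    pull    : ∀ {F G Q S} (v : Pt d) → ¬ IsSimplex F → Minimal F v →
              IsFacetOf G F → ¬ G v → Pull G Q → S ≈ (Q ∪₁ v) → Pull F S

Odd : ℕ → Set
Odd n = n % 2 ≡ 1

record TauB (d : ℕ) : Set where
  field
    τ      : List (Fin d)
    τ-uniq : Unique τ
    B      : Subset d
    B-disj : ∀ i → i ∈ τ → i ∉ B
    B-odd  : Odd ∣ B ∣
    B-ne1  : ¬ (∣ B ∣ ≡ 1)
open TauB public

-- f is a bijection from pairs onto the simplices of Pull_⪯(H_d)
-- (simplices compared as vertex sets, i.e. up to _≈_)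
IsBijectionOntoPull : ∀ {d} (_⪯_ : Pt d → Pt d → Set) → (TauB d → VSet d) → Set₁
IsBijectionOntoPull {d} _⪯_ f =
  (∀ p → Pull _⪯_ (Halfcube d) (f p)) ×
  (∀ S → Pull _⪯_ (Halfcube d) S → ∃ λ p → S ≈ f p) ×
  (∀ p q → f p ≈ f q → τ p ≡ τ q × B p ≡ B q)

-- Fixing some coordinates of H_d cuts out faces Half σ that are again halfcubes, of
-- dimension k = #free σ. For k ≥ 3 their facets are the coordinate facets (one more
-- coordinate fixed) and the corner simplices Corner σ u, the neighbours in Half σ of an
-- odd vertex u; Half σ itself is a simplex exactly when k = 3. Pulling Half σ from its
-- minimal vertex v therefore recurses into the coordinate facets x_i = ¬ v_i and into the
-- corners at u = v ⊕ B with |B| odd and |B| ≠ 1 (for |B| = 1 the corner contains v).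
-- Recording the coordinates i in the order they are fixed gives τ, and the final corner
-- gives B (when k = 3 the whole face, with B its three free coordinates).
-- Facets are recognised through the gains of a supporting functional at one of their
-- vertices; non-simplicity comes from the affine dependency x + y₃ = y₁ + y₂ among four
-- points, and simplicity of the corners from the distance to u.
module Submission where

open import Defs
open import Algebra.Bundles using (AbelianGroup; CommutativeRing)
open import Data.Nat as N using (ℕ; zero; suc; z≤n; s≤s)
import Data.Nat.Properties as NP
import Data.Nat.DivMod as DM
open import Algebra.Properties.CommutativeSemigroup NP.+-commutativeSemigroup using () renaming (x∙yz≈y∙xz to +-lcomm)
open import Data.Integer using (ℤ; +_; -[1+_]; _+_; _*_; -_; _-_; _≤_; _<_; +≤+; +<+)
import Data.Integer.Properties as ZP
open import Data.Integer.Tactic.RingSolver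
open import Algebra.Properties.Group (AbelianGroup.group ZP.+-0-abelianGroup)
  using () renaming (∙-cancelˡ to +-cancelˡ; inverseʳ-unique to i+j≡0⇒j≡-i)
open import Data.Bool using (Bool; true; false; not; _xor_; if_then_else_)
import Data.Bool.Properties as BP
open import Data.Maybe using (Maybe; just; nothing)
import Data.Maybe.Properties as MP
open import Data.Vec using (Vec; []; _∷_; lookup; replicate)
import Data.Vec as V
import Data.Vec.Properties as VP
open import Data.Fin using (Fin; zero; suc)
import Data.Fin.Properties as FP
open import Data.Fin.Subset using (Subset; ∣_∣) renaming (_∈_ to _∈S_; _∉_ to _∉S_)
open import Data.List using (List; []; _∷_; _++_; map; foldr; length)
open import Data.List.Relation.Unary.Any using (here; there)
open import Data.List.Relation.Unary.All using (All; []; _∷_)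
import Data.List.Relation.Unary.All as All
open import Data.List.Relation.Unary.AllPairs using ([]; _∷_)
open import Data.List.Membership.Propositional using () renaming (_∈_ to _∈L_)
open import Data.List.Relation.Unary.Unique.Propositional using (Unique)
open import Data.Product using (Σ; ∃; ∃₂; _×_; _,_; proj₁; proj₂)
open import Data.Sum using (_⊎_; inj₁; inj₂)
open import Data.Unit using (⊤; tt)
open import Data.Empty using (⊥-elim)
open import Relation.Binary.PropositionalEquality
open import Relation.Nullary using (¬_; Dec; yes; no; does)
open import Relation.Nullary.Decidable using (_×-dec_; dec-false)
open import Function using (_∘_)

-- Points of the cube

oddᵇ : ℕ → Bool
oddᵇ zero = false
oddᵇ (suc n) = not (oddᵇ n)

bit : Bool → ℕ
bit true = 1
bit false = 0

%2≡bit-oddᵇ : ∀ n → n N.% 2 ≡ bit (oddᵇ n)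
%2≡bit-oddᵇ zero = refl
%2≡bit-oddᵇ (suc zero) = refl
%2≡bit-oddᵇ (suc (suc n)) = begin
  (2 N.+ n) N.% 2       ≡⟨ cong (N._% 2) (NP.+-comm 2 n) ⟩
  (n N.+ 2) N.% 2       ≡⟨ DM.[m+n]%n≡m%n n 2 ⟩
  n N.% 2               ≡⟨ %2≡bit-oddᵇ n ⟩
  bit (oddᵇ n)          ≡⟨ cong bit (BP.not-involutive (oddᵇ n)) ⟨
  bit (oddᵇ (2 N.+ n))  ∎
  where open ≡-Reasoning

xor-interchange : ∀ a b c d → (a xor b) xor (c xor d) ≡ (a xor c) xor (b xor d)
xor-interchange = interchange
  where open import Algebra.Properties.CommutativeSemigroup
                  (CommutativeRing.+-commutativeSemigroup BP.xor-∧-commutativeRing)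

xor≡false⇒≡ : ∀ a b → a xor b ≡ false → a ≡ b
xor≡false⇒≡ true true e = refl
xor≡false⇒≡ false false e = refl

xor≡true⇒≡not : ∀ a b → a xor b ≡ true → b ≡ not a
xor≡true⇒≡not true false _ = refl
xor≡true⇒≡not false true _ = refl

≢⇒≡not : ∀ a b → a ≢ b → a ≡ not b
≢⇒≡not true true n = ⊥-elim (n refl)
≢⇒≡not true false n = refl
≢⇒≡not false true n = refl
≢⇒≡not false false n = ⊥-elim (n refl)

not≢self : ∀ b → not b ≢ b
not≢self b e = BP.not-¬ refl (sym e)

parity : ∀ {d} → Pt d → Bool
parity [] = false
parity (b ∷ x) = b xor parity x

oddᵇ-weight : ∀ {d} (x : Pt d) → oddᵇ (weight x) ≡ parity x
oddᵇ-weight [] = refl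
oddᵇ-weight (true ∷ x) = cong not (oddᵇ-weight x)
oddᵇ-weight (false ∷ x) = oddᵇ-weight x

HVert⇒even : ∀ {d} (x : Pt d) → HVert x → parity x ≡ false
HVert⇒even x h with parity x | oddᵇ-weight x
... | false | _ = refl
... | true | e with () ← trans (cong bit (sym e)) (trans (sym (%2≡bit-oddᵇ (weight x))) h)

even⇒HVert : ∀ {d} (x : Pt d) → parity x ≡ false → HVert x
even⇒HVert x p = trans (%2≡bit-oddᵇ (weight x)) (cong bit (trans (oddᵇ-weight x) p))

toggle : ∀ {d} → Pt d → Fin d → Pt d
toggle (b ∷ v) zero = not b ∷ v
toggle (b ∷ v) (suc j) = b ∷ toggle v j

lookup-toggle-same : ∀ {d} (x : Pt d) j → lookup (toggle x j) j ≡ not (lookup x j)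
lookup-toggle-same (b ∷ x) zero = refl
lookup-toggle-same (b ∷ x) (suc j) = lookup-toggle-same x j

lookup-toggle-other : ∀ {d} (x : Pt d) j k → k ≢ j → lookup (toggle x j) k ≡ lookup x k
lookup-toggle-other (b ∷ x) zero zero ne = ⊥-elim (ne refl)
lookup-toggle-other (b ∷ x) zero (suc k) ne = refl
lookup-toggle-other (b ∷ x) (suc j) zero ne = refl
lookup-toggle-other (b ∷ x) (suc j) (suc k) ne = lookup-toggle-other x j k (ne ∘ cong suc)

parity-toggle : ∀ {d} (x : Pt d) j → parity (toggle x j) ≡ not (parity x)
parity-toggle (b ∷ x) zero = sym (BP.not-distribˡ-xor b (parity x))
parity-toggle (b ∷ x) (suc j) =
  trans (cong (b xor_) (parity-toggle x j)) (sym (BP.not-distribʳ-xor b (parity x)))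

toggle-involutive : ∀ {d} (x : Pt d) j → toggle (toggle x j) j ≡ x
toggle-involutive (b ∷ x) zero = cong (_∷ x) (BP.not-involutive b)
toggle-involutive (b ∷ x) (suc j) = cong (b ∷_) (toggle-involutive x j)

toggle-injectiveʳ : ∀ {d} (u : Pt d) k l → toggle u k ≡ toggle u l → k ≡ l
toggle-injectiveʳ u k l e with k FP.≟ l
... | yes k≡l = k≡l
... | no k≢l = ⊥-elim (not≢self (lookup u k)
  (trans (sym (lookup-toggle-same u k)) (trans (cong (λ z → lookup z k) e) (lookup-toggle-other u l k k≢l))))

lookup-ext : ∀ {d} {A : Set} (x y : Vec A d) → (∀ j → lookup x j ≡ lookup y j) → x ≡ y
lookup-ext [] [] h = refl
lookup-ext (a ∷ x) (b ∷ y) h = cong₂ _∷_ (h zero) (lookup-ext x y (h ∘ suc))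

Differ : ∀ {d} → Pt d → Pt d → Fin d → Set
Differ x y j = lookup x j xor lookup y j ≡ true

infixl 6 _⊕_

_⊕_ : ∀ {d} → Pt d → Pt d → Pt d

[] ⊕ [] = []

(a ∷ u) ⊕ (b ∷ x) = (a xor b) ∷ u ⊕ x

lookup-⊕ : ∀ {d} (u x : Pt d) j → lookup (u ⊕ x) j ≡ lookup u j xor lookup x j
lookup-⊕ (a ∷ u) (b ∷ x) zero = refl
lookup-⊕ (a ∷ u) (b ∷ x) (suc j) = lookup-⊕ u x j

⊕-cancel : ∀ {d} (v B : Pt d) → v ⊕ (v ⊕ B) ≡ B
⊕-cancel [] [] = refl
⊕-cancel (a ∷ v) (b ∷ B) =
  cong₂ _∷_ (trans (sym (BP.xor-assoc a a b)) (cong (_xor b) (BP.xor-same a))) (⊕-cancel v B)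

∣∣≡weight : ∀ {d} (B : Subset d) → ∣ B ∣ ≡ weight B
∣∣≡weight [] = refl
∣∣≡weight (true ∷ B) = cong suc (∣∣≡weight B)
∣∣≡weight (false ∷ B) = ∣∣≡weight B

dist : ∀ {d} → Pt d → Pt d → ℕ
dist [] [] = 0
dist (a ∷ u) (b ∷ x) = bit (a xor b) N.+ dist u x

dist-self : ∀ {d} (u : Pt d) → dist u u ≡ 0
dist-self [] = refl
dist-self (a ∷ u) rewrite BP.xor-same a = dist-self u

dist≡0⇒≡ : ∀ {d} (u x : Pt d) → dist u x ≡ 0 → u ≡ x
dist≡0⇒≡ [] [] e = refl
dist≡0⇒≡ (a ∷ u) (b ∷ x) e with a xor b in eq
... | false = cong₂ _∷_ (xor≡false⇒≡ a b eq) (dist≡0⇒≡ u x e)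

dist-sym : ∀ {d} (u x : Pt d) → dist u x ≡ dist x u
dist-sym [] [] = refl
dist-sym (a ∷ u) (b ∷ x) = cong₂ N._+_ (cong bit (BP.xor-comm a b)) (dist-sym u x)

dist-toggle : ∀ {d} (u : Pt d) l → dist u (toggle u l) ≡ 1
dist-toggle (a ∷ u) zero rewrite BP.xor-inverseʳ a = cong suc (dist-self u)
dist-toggle (a ∷ u) (suc l) rewrite BP.xor-same a = dist-toggle u l

dist≡1⇒toggle : ∀ {d} (u x : Pt d) → dist u x ≡ 1 → Σ (Fin d) λ l → x ≡ toggle u l
dist≡1⇒toggle [] [] ()
dist≡1⇒toggle (a ∷ u) (b ∷ x) e with a xor b in eq
... | true = zero , cong₂ _∷_ (xor≡true⇒≡not a b eq) (sym (dist≡0⇒≡ u x (NP.suc-injective e)))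
... | false with l , e' ← dist≡1⇒toggle u x e = suc l , cong₂ _∷_ (sym (xor≡false⇒≡ a b eq)) e'

dist-⊕ : ∀ {d} (v B : Pt d) → dist v (v ⊕ B) ≡ weight B
dist-⊕ [] [] = refl
dist-⊕ (a ∷ v) (b ∷ B) rewrite sym (BP.xor-assoc a a b) | BP.xor-same a with b
... | true = cong suc (dist-⊕ v B)
... | false = dist-⊕ v B

oddᵇ-dist : ∀ {d} (u x : Pt d) → oddᵇ (dist u x) ≡ parity u xor parity x
oddᵇ-dist [] [] = refl
oddᵇ-dist (a ∷ u) (b ∷ x) = begin
  oddᵇ (bit (a xor b) N.+ dist u x)      ≡⟨ oddᵇ-bit+ (a xor b) (dist u x) ⟩
  (a xor b) xor oddᵇ (dist u x)          ≡⟨ cong ((a xor b) xor_) (oddᵇ-dist u x) ⟩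
  (a xor b) xor (parity u xor parity x)  ≡⟨ xor-interchange a b (parity u) (parity x) ⟩
  parity (a ∷ u) xor parity (b ∷ x)      ∎
  where
  open ≡-Reasoning
  oddᵇ-bit+ : ∀ c n → oddᵇ (bit c N.+ n) ≡ c xor oddᵇ n
  oddᵇ-bit+ true n = refl
  oddᵇ-bit+ false n = refl

dist-even : ∀ {d} (x y : Pt d) → HVert x → HVert y → oddᵇ (dist x y) ≡ false
dist-even x y hx hy = trans (oddᵇ-dist x y) (cong₂ _xor_ (HVert⇒even x hx) (HVert⇒even y hy))

dist-odd : ∀ {d} (u y : Pt d) → parity u ≡ true → HVert y → oddᵇ (dist u y) ≡ true
dist-odd u y odd hy = trans (oddᵇ-dist u y) (cong₂ _xor_ odd (HVert⇒even y hy))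

parity-⊕ : ∀ {d} (v B : Pt d) → parity (v ⊕ B) ≡ parity v xor oddᵇ (weight B)
parity-⊕ v B = begin
  parity (v ⊕ B)                           ≡⟨ cancel (parity v) (parity (v ⊕ B)) ⟨
  parity v xor (parity v xor parity (v ⊕ B)) ≡⟨ cong (parity v xor_) (oddᵇ-dist v (v ⊕ B)) ⟨
  parity v xor oddᵇ (dist v (v ⊕ B))       ≡⟨ cong (λ n → parity v xor oddᵇ n) (dist-⊕ v B) ⟩
  parity v xor oddᵇ (weight B)             ∎
  where
  open ≡-Reasoning
  cancel : ∀ p q → p xor (p xor q) ≡ q
  cancel p q = trans (sym (BP.xor-assoc p p q)) (cong (_xor q) (BP.xor-same p))

Odd⇒oddᵇ : ∀ n → Odd n → oddᵇ n ≡ true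
Odd⇒oddᵇ n odd with oddᵇ n in e
... | true = refl
... | false with () ← trans (sym odd) (trans (%2≡bit-oddᵇ n) (cong bit e))

oddᵇ⇒Odd : ∀ n → oddᵇ n ≡ true → Odd n
oddᵇ⇒Odd n e = trans (%2≡bit-oddᵇ n) (cong bit e)

odd≢1⇒≥3 : ∀ n → Odd n → n ≢ 1 → 3 N.≤ n
odd≢1⇒≥3 (suc zero) _ n≢1 = ⊥-elim (n≢1 refl)
odd≢1⇒≥3 (suc (suc (suc n))) _ _ = s≤s (s≤s (s≤s z≤n))

toggle₂ : ∀ {d} → Pt d → Fin d → Fin d → Pt d
toggle₂ x j l = toggle (toggle x j) l

lookup-toggle₂-first : ∀ {d} (x : Pt d) j l → l ≢ j → lookup (toggle₂ x j l) j ≡ not (lookup x j)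
lookup-toggle₂-first x j l l≢j = trans (lookup-toggle-other (toggle x j) l j (l≢j ∘ sym)) (lookup-toggle-same x j)

lookup-toggle₂-other : ∀ {d} (x : Pt d) j l k → k ≢ j → k ≢ l → lookup (toggle₂ x j l) k ≡ lookup x k
lookup-toggle₂-other x j l k k≢j k≢l =
  trans (lookup-toggle-other (toggle x j) l k k≢l) (lookup-toggle-other x j k k≢j)

toggle₂≢ : ∀ {d} (x : Pt d) j l → l ≢ j → toggle₂ x j l ≢ x
toggle₂≢ x j l l≢j e =
  not≢self (lookup x j) (trans (sym (lookup-toggle₂-first x j l l≢j)) (cong (λ z → lookup z j) e))

lookup-toggle-xor : ∀ {d} (z : Pt d) j i → lookup (toggle z j) i ≡ lookup z i xor does (i FP.≟ j)
lookup-toggle-xor z j i with i FP.≟ j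
... | yes refl = trans (lookup-toggle-same z i) (trans (sym (BP.true-xor (lookup z i))) (BP.xor-comm true (lookup z i)))
... | no i≢j = trans (lookup-toggle-other z j i i≢j) (sym (BP.xor-identityʳ (lookup z i)))

_≟ₚ_ : ∀ {d} (x y : Pt d) → Dec (x ≡ y)
_≟ₚ_ = VP.≡-dec BP._≟_

∃Pt? : ∀ d (P : Pt d → Set) → (∀ x → Dec (P x)) → Dec (Σ (Pt d) P)
∃Pt? zero P P? with P? []
... | yes p = yes ([] , p)
... | no ¬p = no λ { ([] , p) → ¬p p }
∃Pt? (suc d) P P? with ∃Pt? d (P ∘ (true ∷_)) (P? ∘ (true ∷_)) | ∃Pt? d (P ∘ (false ∷_)) (P? ∘ (false ∷_))
... | yes (x , p) | _ = yes (true ∷ x , p)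
... | no _ | yes (x , p) = yes (false ∷ x , p)
... | no ¬t | no ¬f = no λ { (true ∷ x , p) → ¬t (x , p) ; (false ∷ x , p) → ¬f (x , p) }

HVert? : ∀ {d} (x : Pt d) → Dec (HVert x)
HVert? x = weight x N.% 2 NP.≟ 0

-- Patterns and sub-halfcubes

-- A pattern prescribes some coordinates (just b); the vertices of H_d matching σ
-- form a face Half σ of H_d isomorphic to the halfcube H_k, k = #free σ.
Pattern : ℕ → Set
Pattern d = Vec (Maybe Bool) d

Matches : ∀ {d} → Pattern d → Pt d → Set
Matches [] [] = ⊤
Matches (nothing ∷ σ) (b ∷ x) = Matches σ x
Matches (just a ∷ σ) (b ∷ x) = a ≡ b × Matches σ x

Half : ∀ {d} → Pattern d → VSet d
Half σ x = HVert x × Matches σ x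

≈-refl : ∀ {d} {A : VSet d} → A ≈ A
≈-refl = (λ _ a → a) , (λ _ a → a)

≈-sym : ∀ {d} {A B : VSet d} → A ≈ B → B ≈ A
≈-sym (A⊆B , B⊆A) = B⊆A , A⊆B

≈-trans : ∀ {d} {A B C : VSet d} → A ≈ B → B ≈ C → A ≈ C
≈-trans (A⊆B , B⊆A) (B⊆C , C⊆B) = (λ v → B⊆C v ∘ A⊆B v) , (λ v → B⊆A v ∘ C⊆B v)

Free : ∀ {d} → Pattern d → Fin d → Set
Free σ j = lookup σ j ≡ nothing

#free : ∀ {d} → Pattern d → ℕ
#free [] = 0
#free (nothing ∷ σ) = suc (#free σ)
#free (just _ ∷ σ) = #free σ

Corner : ∀ {d} → Pattern d → Pt d → VSet d
Corner σ u x = Half σ x × dist u x ≡ 1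

Matches⇒lookup : ∀ {d} (σ : Pattern d) x → Matches σ x → ∀ j a → lookup σ j ≡ just a → lookup x j ≡ a
Matches⇒lookup (just a' ∷ σ) (b ∷ x) (e , ag) zero a refl = sym e
Matches⇒lookup (nothing ∷ σ) (b ∷ x) ag (suc j) a e = Matches⇒lookup σ x ag j a e
Matches⇒lookup (just a' ∷ σ) (b ∷ x) (_ , ag) (suc j) a e = Matches⇒lookup σ x ag j a e

lookup⇒Matches : ∀ {d} (σ : Pattern d) x → (∀ j a → lookup σ j ≡ just a → lookup x j ≡ a) → Matches σ x
lookup⇒Matches [] [] h = tt
lookup⇒Matches (nothing ∷ σ) (b ∷ x) h = lookup⇒Matches σ x (h ∘ suc)
lookup⇒Matches (just a ∷ σ) (b ∷ x) h = sym (h zero a refl) , lookup⇒Matches σ x (h ∘ suc)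

Free⇒≢just : ∀ {d} (σ : Pattern d) j {a} → Free σ j → lookup σ j ≢ just a
Free⇒≢just σ j fr e with () ← trans (sym fr) e

Matches-toggle : ∀ {d} (σ : Pattern d) x j → Free σ j → Matches σ x → Matches σ (toggle x j)
Matches-toggle σ x j fr ag = lookup⇒Matches σ (toggle x j) fixed
  where
  fixed : ∀ k a → lookup σ k ≡ just a → lookup (toggle x j) k ≡ a
  fixed k a e with k FP.≟ j
  ... | yes refl = ⊥-elim (Free⇒≢just σ k fr e)
  ... | no ne = trans (lookup-toggle-other x j k ne) (Matches⇒lookup σ x ag k a e)

Differ⇒Free : ∀ {d} (σ : Pattern d) x y j → Matches σ x → Matches σ y → Differ x y j → Free σ j
Differ⇒Free σ x y j ax ay dj with lookup σ j in eq
... | nothing = refl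
... | just a rewrite Matches⇒lookup σ x ax j a eq | Matches⇒lookup σ y ay j a eq | BP.xor-same a
  with () ← dj

Matches-⊕ : ∀ {d} (σ : Pattern d) v B → Matches σ v → (∀ i → lookup B i ≡ true → Free σ i) →
            Matches σ (v ⊕ B)
Matches-⊕ σ v B av free = lookup⇒Matches σ (v ⊕ B) λ j a e → trans (lookup-⊕ v B j) (fixed j a e)
  where
  fixed : ∀ j a → lookup σ j ≡ just a → lookup v j xor lookup B j ≡ a
  fixed j a e with lookup B j in eb
  ... | true = ⊥-elim (Free⇒≢just σ j (free j eb) e)
  ... | false = trans (BP.xor-identityʳ _) (Matches⇒lookup σ v av j a e)

dist≤#free : ∀ {d} (σ : Pattern d) x y → Matches σ x → Matches σ y → dist x y N.≤ #free σ
dist≤#free [] [] [] _ _ = z≤n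
dist≤#free (nothing ∷ σ) (a ∷ x) (b ∷ y) ax ay with a xor b
... | true = s≤s (dist≤#free σ x y ax ay)
... | false = NP.m≤n⇒m≤1+n (dist≤#free σ x y ax ay)
dist≤#free (just a ∷ σ) (b ∷ x) (c ∷ y) (refl , ax) (refl , ay) rewrite BP.xor-same a =
  dist≤#free σ x y ax ay

dist≡#free⇒opposite : ∀ {d} (σ : Pattern d) x y → Matches σ x → Matches σ y → dist x y ≡ #free σ →
                      ∀ j → Free σ j → lookup y j ≡ not (lookup x j)
dist≡#free⇒opposite (nothing ∷ σ) (a ∷ x) (b ∷ y) ax ay e j fr with a xor b in eq
... | false = ⊥-elim (NP.<-irrefl e (s≤s (dist≤#free σ x y ax ay)))
dist≡#free⇒opposite (nothing ∷ σ) (a ∷ x) (b ∷ y) ax ay e zero fr | true = xor≡true⇒≡not a b eq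
dist≡#free⇒opposite (nothing ∷ σ) (a ∷ x) (b ∷ y) ax ay e (suc j) fr | true =
  dist≡#free⇒opposite σ x y ax ay (NP.suc-injective e) j fr
dist≡#free⇒opposite (just a ∷ σ) (b ∷ x) (c ∷ y) (refl , ax) (refl , ay) e (suc j) fr
  rewrite BP.xor-same a = dist≡#free⇒opposite σ x y ax ay e j fr

weight≤#free : ∀ {d} (σ : Pattern d) B → (∀ i → lookup B i ≡ true → Free σ i) → weight B N.≤ #free σ
weight≤#free [] [] h = z≤n
weight≤#free (nothing ∷ σ) (true ∷ B) h = s≤s (weight≤#free σ B (h ∘ suc))
weight≤#free (nothing ∷ σ) (false ∷ B) h = NP.m≤n⇒m≤1+n (weight≤#free σ B (h ∘ suc))
weight≤#free (just a ∷ σ) (true ∷ B) h with () ← h zero refl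
weight≤#free (just a ∷ σ) (false ∷ B) h = weight≤#free σ B (h ∘ suc)

fix : ∀ {d} → Pattern d → Fin d → Bool → Pattern d
fix (_ ∷ σ) zero b = just b ∷ σ
fix (a ∷ σ) (suc j) b = a ∷ fix σ j b

lookup-fix-same : ∀ {d} (σ : Pattern d) j b → lookup (fix σ j b) j ≡ just b
lookup-fix-same (_ ∷ σ) zero b = refl
lookup-fix-same (a ∷ σ) (suc j) b = lookup-fix-same σ j b

lookup-fix-other : ∀ {d} (σ : Pattern d) j b k → k ≢ j → lookup (fix σ j b) k ≡ lookup σ k
lookup-fix-other (_ ∷ σ) zero b zero ne = ⊥-elim (ne refl)
lookup-fix-other (_ ∷ σ) zero b (suc k) ne = refl
lookup-fix-other (a ∷ σ) (suc j) b zero ne = refl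
lookup-fix-other (a ∷ σ) (suc j) b (suc k) ne = lookup-fix-other σ j b k (ne ∘ cong suc)

#free-fix : ∀ {d} (σ : Pattern d) j b → Free σ j → suc (#free (fix σ j b)) ≡ #free σ
#free-fix (nothing ∷ σ) zero b e = refl
#free-fix (nothing ∷ σ) (suc j) b e = cong suc (#free-fix σ j b e)
#free-fix (just x ∷ σ) (suc j) b e = #free-fix σ j b e

Matches-fix⁻ : ∀ {d} (σ : Pattern d) j b x → Free σ j → Matches (fix σ j b) x → Matches σ x × lookup x j ≡ b
Matches-fix⁻ σ j b x fj m = lookup⇒Matches σ x fixed , Matches⇒lookup (fix σ j b) x m j b (lookup-fix-same σ j b)
  where
  fixed : ∀ k a → lookup σ k ≡ just a → lookup x k ≡ a
  fixed k a e with k FP.≟ j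
  ... | yes refl = ⊥-elim (Free⇒≢just σ j fj e)
  ... | no k≢j = Matches⇒lookup (fix σ j b) x m k a (trans (lookup-fix-other σ j b k k≢j) e)

Matches-fix⁺ : ∀ {d} (σ : Pattern d) j b x → Matches σ x → lookup x j ≡ b → Matches (fix σ j b) x
Matches-fix⁺ σ j b x m xj = lookup⇒Matches (fix σ j b) x fixed
  where
  fixed : ∀ k a → lookup (fix σ j b) k ≡ just a → lookup x k ≡ a
  fixed k a e with k FP.≟ j
  ... | yes refl = trans xj (MP.just-injective (trans (sym (lookup-fix-same σ j b)) e))
  ... | no k≢j = Matches⇒lookup σ x m k a (trans (sym (lookup-fix-other σ j b k k≢j)) e)

Free-fix⁻ : ∀ {d} (σ : Pattern d) j b k → Free (fix σ j b) k → k ≢ j × Free σ k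
Free-fix⁻ σ j b k fk with k FP.≟ j
... | yes refl with () ← trans (sym (lookup-fix-same σ j b)) fk
... | no k≢j = k≢j , trans (sym (lookup-fix-other σ j b k k≢j)) fk

Free-fix⁺ : ∀ {d} (σ : Pattern d) j b k → k ≢ j → Free σ k → Free (fix σ j b) k
Free-fix⁺ σ j b k k≢j fk = trans (lookup-fix-other σ j b k k≢j) fk

#free≤1+#free-fix : ∀ {d} (σ : Pattern d) j b → #free σ N.≤ suc (#free (fix σ j b))
#free≤1+#free-fix (nothing ∷ σ) zero b = NP.≤-refl
#free≤1+#free-fix (just _ ∷ σ) zero b = NP.n≤1+n (#free σ)
#free≤1+#free-fix (nothing ∷ σ) (suc j) b = s≤s (#free≤1+#free-fix σ j b)
#free≤1+#free-fix (just _ ∷ σ) (suc j) b = #free≤1+#free-fix σ j b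

freeOutside : ∀ {d} (σ : Pattern d) (ks : List (Fin d)) → length ks N.< #free σ →
              Σ (Fin d) λ j → Free σ j × All (j ≢_) ks
freeOutside (nothing ∷ σ) [] _ = zero , refl , []
freeOutside (just _ ∷ σ) [] h with j , fj , [] ← freeOutside σ [] h = suc j , fj , []
freeOutside σ (k ∷ ks) h
  with j , fj , outside ← freeOutside (fix σ k true) ks (NP.≤-pred (NP.≤-trans h (#free≤1+#free-fix σ k true)))
  = j , proj₂ (Free-fix⁻ σ k true j fj) , proj₁ (Free-fix⁻ σ k true j fj) ∷ outside

basePoint : ∀ {d} → Pattern d → Pt d
basePoint [] = []
basePoint (nothing ∷ σ) = false ∷ basePoint σ
basePoint (just a ∷ σ) = a ∷ basePoint σ

Matches-basePoint : ∀ {d} (σ : Pattern d) → Matches σ (basePoint σ)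
Matches-basePoint [] = tt
Matches-basePoint (nothing ∷ σ) = Matches-basePoint σ
Matches-basePoint (just a ∷ σ) = refl , Matches-basePoint σ

Half-nonempty : ∀ {d} (σ : Pattern d) → 1 N.≤ #free σ → Σ (Pt d) (Half σ)
Half-nonempty σ h with parity (basePoint σ) in eq
... | false = basePoint σ , even⇒HVert (basePoint σ) eq , Matches-basePoint σ
... | true with j , fj , [] ← freeOutside σ [] h =
  toggle (basePoint σ) j ,
  even⇒HVert (toggle (basePoint σ) j) (trans (parity-toggle (basePoint σ) j) (cong not eq)) ,
  Matches-toggle σ (basePoint σ) j fj (Matches-basePoint σ)

Half-toggle₂ : ∀ {d} (σ : Pattern d) x j l → Free σ j → Free σ l → Half σ x → Half σ (toggle₂ x j l)
Half-toggle₂ σ x j l fj fl (hx , mx) =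
  even⇒HVert (toggle₂ x j l) even , Matches-toggle σ _ l fl (Matches-toggle σ x j fj mx)
  where
  even : parity (toggle₂ x j l) ≡ false
  even = begin
    parity (toggle (toggle x j) l) ≡⟨ parity-toggle (toggle x j) l ⟩
    not (parity (toggle x j))      ≡⟨ cong not (parity-toggle x j) ⟩
    not (not (parity x))           ≡⟨ BP.not-involutive (parity x) ⟩
    parity x                       ≡⟨ HVert⇒even x hx ⟩
    false                          ∎
    where open ≡-Reasoning

Free? : ∀ {d} (σ : Pattern d) j → Dec (Free σ j)
Free? σ j with lookup σ j
... | nothing = yes refl
... | just _ = no λ ()

Matches? : ∀ {d} (σ : Pattern d) x → Dec (Matches σ x)
Matches? [] [] = yes tt
Matches? (nothing ∷ σ) (b ∷ x) = Matches? σ x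
Matches? (just a ∷ σ) (b ∷ x) = (a BP.≟ b) ×-dec Matches? σ x

Half? : ∀ {d} (σ : Pattern d) x → Dec (Half σ x)
Half? σ x = HVert? x ×-dec Matches? σ x

Corner? : ∀ {d} (σ : Pattern d) u v → Dec (Corner σ u v)
Corner? σ u v = Half? σ v ×-dec (dist u v NP.≟ 1)

singletonPattern : ∀ {d} → Pt d → Pattern d
singletonPattern = V.map just

Matches-singleton⁻ : ∀ {d} (y v : Pt d) → Matches (singletonPattern y) v → v ≡ y
Matches-singleton⁻ [] [] _ = refl
Matches-singleton⁻ (a ∷ y) (b ∷ v) (a≡b , m) = cong₂ _∷_ (sym a≡b) (Matches-singleton⁻ y v m)

Matches-singleton⁺ : ∀ {d} (y : Pt d) → Matches (singletonPattern y) y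
Matches-singleton⁺ [] = tt
Matches-singleton⁺ (a ∷ y) = refl , Matches-singleton⁺ y

fix⊆Half : ∀ {d} (σ : Pattern d) j b → Free σ j → Half (fix σ j b) ⊆ Half σ
fix⊆Half σ j b fj v (hv , m) = hv , proj₁ (Matches-fix⁻ σ j b v fj m)

toggle∈Corner : ∀ {d} (σ : Pattern d) u → Matches σ u → parity u ≡ true →
                ∀ k → Free σ k → Corner σ u (toggle u k)
toggle∈Corner σ u mu odd k fk =
  (even⇒HVert (toggle u k) (trans (parity-toggle u k) (cong not odd)) , Matches-toggle σ u k fk mu) , dist-toggle u k

two-opposite⇒dist≢1 : ∀ {d} (u w : Pt d) k j → j ≢ k →
  lookup w k ≡ not (lookup u k) → lookup w j ≡ not (lookup u j) → dist u w ≢ 1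
two-opposite⇒dist≢1 u w k j j≢k wk wj d≡1 with m , refl ← dist≡1⇒toggle u w d≡1 with k FP.≟ m
... | no k≢m = not≢self (lookup u k) (sym (trans (sym (lookup-toggle-other u m k k≢m)) wk))
... | yes refl = not≢self (lookup u j) (sym (trans (sym (lookup-toggle-other u k j j≢k)) wj))

Half⊈fix : ∀ {d} (σ : Pattern d) j b → Free σ j → 2 N.≤ #free σ →
           ∃ λ v → Half σ v × ¬ Half (fix σ j b) v
Half⊈fix σ j b fj h2
  with x , hx ← Half-nonempty σ (NP.<⇒≤ h2) | l , fl , l≢j ∷ [] ← freeOutside σ (j ∷ []) h2
  with lookup x j BP.≟ b
... | no xj≢b = x , hx , xj≢b ∘ proj₂ ∘ Matches-fix⁻ σ j b x fj ∘ proj₂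
... | yes xj≡b = toggle₂ x j l , Half-toggle₂ σ x j l fj fl hx , λ (_ , m) →
  not≢self b (trans (sym (trans (lookup-toggle₂-first x j l l≢j) (cong not xj≡b)))
                    (proj₂ (Matches-fix⁻ σ j b _ fj m)))

Half⊈Corner : ∀ {d} (σ : Pattern d) u → Matches σ u → parity u ≡ true → 3 N.≤ #free σ →
              ∃ λ v → Half σ v × ¬ Corner σ u v
Half⊈Corner σ u mu odd h3
  with k , fk , [] ← freeOutside σ [] (NP.<⇒≤ (NP.<⇒≤ h3))
  with j , fj , j≢k ∷ [] ← freeOutside σ (k ∷ []) (NP.<⇒≤ h3)
  with l , fl , l≢k ∷ l≢j ∷ [] ← freeOutside σ (k ∷ j ∷ []) h3
  = w , Half-toggle₂ σ x j l fj fl (proj₁ (toggle∈Corner σ u mu odd k fk)) ,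
    λ c → two-opposite⇒dist≢1 u w k j j≢k wk wj (proj₂ c)
  where
  x = toggle u k
  w = toggle₂ x j l
  wk : lookup w k ≡ not (lookup u k)
  wk = trans (lookup-toggle₂-other x j l k (j≢k ∘ sym) (l≢k ∘ sym)) (lookup-toggle-same u k)
  wj : lookup w j ≡ not (lookup u j)
  wj = trans (lookup-toggle₂-first x j l l≢j) (cong not (lookup-toggle-other u k j j≢k))

Corner-avoids : ∀ {d} (σ : Pattern d) u → Matches σ u → parity u ≡ true → 2 N.≤ #free σ →
                ∀ i → Free σ i → ∀ b → ∃ λ x → Corner σ u x × lookup x i ≢ b
Corner-avoids σ u mu odd h2 i fi b with lookup u i BP.≟ b
... | yes ui≡b = toggle u i , toggle∈Corner σ u mu odd i fi ,
                 λ e → not≢self b (trans (cong not (sym ui≡b)) (trans (sym (lookup-toggle-same u i)) e))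
... | no ui≢b with k , fk , k≢i ∷ [] ← freeOutside σ (i ∷ []) h2 =
  toggle u k , toggle∈Corner σ u mu odd k fk , ui≢b ∘ trans (sym (lookup-toggle-other u k i (k≢i ∘ sym)))

Corner-lookup : ∀ {d} (u w : Pt d) l → dist u w ≡ 1 → w ≢ toggle u l → lookup w l ≡ lookup u l
Corner-lookup u w l d≡1 w≢ with m , refl ← dist≡1⇒toggle u w d≡1 with l FP.≟ m
... | yes refl = ⊥-elim (w≢ refl)
... | no l≢m = lookup-toggle-other u m l l≢m

Half₃-cover : ∀ {d} (σ : Pattern d) → #free σ ≡ 3 → ∀ v u → Half σ v → Matches σ u → parity u ≡ true →
              dist u v ≡ 3 → Half σ ⊆ (Corner σ u ∪₁ v)
Half₃-cover σ n≡3 v u hv mu odd uv≡3 w hw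
  with dist u w in uw | subst (dist u w N.≤_) n≡3 (dist≤#free σ u w mu (proj₂ hw))
... | 1 | _ = inj₁ (hw , refl)
... | 3 | _ = inj₂ (lookup-ext w v same)
  where
  same : ∀ i → lookup w i ≡ lookup v i
  same i with lookup σ i in σi
  ... | nothing = trans (dist≡#free⇒opposite σ u w mu (proj₂ hw) (trans uw (sym n≡3)) i σi)
                        (sym (dist≡#free⇒opposite σ u v mu (proj₂ hv) (trans uv≡3 (sym n≡3)) i σi))
  ... | just a = trans (Matches⇒lookup σ w (proj₂ hw) i a σi) (sym (Matches⇒lookup σ v (proj₂ hv) i a σi))
... | 0 | _ with () ← trans (cong oddᵇ (sym uw)) (dist-odd u w odd (proj₁ hw))
... | 2 | _ with () ← trans (cong oddᵇ (sym uw)) (dist-odd u w odd (proj₁ hw))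
... | suc (suc (suc (suc _))) | s≤s (s≤s (s≤s ()))

freeSet : ∀ {d} → Pattern d → Subset d
freeSet [] = []
freeSet (nothing ∷ σ) = true ∷ freeSet σ
freeSet (just _ ∷ σ) = false ∷ freeSet σ

freeSet-free : ∀ {d} (σ : Pattern d) i → lookup (freeSet σ) i ≡ true → Free σ i
freeSet-free (nothing ∷ σ) zero e = refl
freeSet-free (nothing ∷ σ) (suc i) e = freeSet-free σ i e
freeSet-free (just _ ∷ σ) (suc i) e = freeSet-free σ i e

weight-freeSet : ∀ {d} (σ : Pattern d) → weight (freeSet σ) ≡ #free σ
weight-freeSet [] = refl
weight-freeSet (nothing ∷ σ) = cong suc (weight-freeSet σ)
weight-freeSet (just _ ∷ σ) = weight-freeSet σ

allFree : (d : ℕ) → Pattern d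
allFree d = replicate d nothing

Matches-allFree : ∀ {d} (v : Pt d) → Matches (allFree d) v
Matches-allFree [] = tt
Matches-allFree (_ ∷ v) = Matches-allFree v

#free-allFree : ∀ d → #free (allFree d) ≡ d
#free-allFree zero = refl
#free-allFree (suc d) = cong suc (#free-allFree d)

Halfcube≈Half-allFree : ∀ d → Halfcube d ≈ Half (allFree d)
Halfcube≈Half-allFree d = (λ v hv → hv , Matches-allFree v) , (λ _ → proj₁)

-- Integer arithmetic

ℤ-interchange : ∀ a b c e → (a + b) + (c + e) ≡ (a + c) + (b + e)
ℤ-interchange = solve-∀

i+j≡i⇒j≡0 : ∀ i j → i + j ≡ i → j ≡ + 0
i+j≡i⇒j≡0 i j e = +-cancelˡ i j (+ 0) (trans e (sym (ZP.+-identityʳ i)))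

i+j≤i⇒j≤0 : ∀ i j → i + j ≤ i → j ≤ + 0
i+j≤i⇒j≤0 i j h = subst₂ _≤_ (cancel i j) (ZP.+-inverseˡ i) (ZP.+-monoʳ-≤ (- i) h)
  where
  cancel : ∀ i j → - i + (i + j) ≡ j
  cancel = solve-∀

i+j≡k⇒i≡k-j : ∀ i j k → i + j ≡ k → i ≡ k - j
i+j≡k⇒i≡k-j i j k e = trans (cancel i j) (cong (_- j) e)
  where
  cancel : ∀ i j → i ≡ i + j - j
  cancel = solve-∀

i+j≤0⇒j≤-i : ∀ i j → i + j ≤ + 0 → j ≤ - i
i+j≤0⇒j≤-i i j h = subst₂ _≤_ (cancel i j) (ZP.+-identityʳ (- i)) (ZP.+-monoʳ-≤ (- i) h)
  where
  cancel : ∀ i j → - i + (i + j) ≡ j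
  cancel = solve-∀

nonpos+nonpos≡0⇒≡0 : ∀ i j → i ≤ + 0 → j ≤ + 0 → i + j ≡ + 0 → i ≡ + 0
nonpos+nonpos≡0⇒≡0 i j i≤0 j≤0 e = ZP.≤-antisym i≤0 (subst (+ 0 ≤_) (sym i≡-j) (ZP.neg-mono-≤ j≤0))
  where
  i≡-j : i ≡ - j
  i≡-j = trans (sym (ZP.neg-involutive i)) (cong -_ (sym (i+j≡0⇒j≡-i i j e)))

pairwise+≡0⇒≡0 : ∀ a b c → a + b ≡ + 0 → a + c ≡ + 0 → b + c ≡ + 0 → a ≡ + 0
pairwise+≡0⇒≡0 a b c ab ac bc = ZP.*-cancelˡ-≡ (+ 2) a (+ 0) (begin
  + 2 * a                            ≡⟨ twice a b c ⟩
  ((a + b) + (a + c)) + - (b + c)    ≡⟨ cong₂ (λ s t → s + - t) (cong₂ _+_ ab ac) bc ⟩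
  + 0                                ∎)
  where
  open ≡-Reasoning
  twice : ∀ a b c → + 2 * a ≡ ((a + b) + (a + c)) + - (b + c)
  twice = solve-∀

0≤n*-a⇒n≡0 : ∀ a n → + 0 < a → + 0 ≤ + n * - a → n ≡ 0
0≤n*-a⇒n≡0 (+ zero) n (+<+ ()) _
0≤n*-a⇒n≡0 (+ suc _) zero _ _ = refl
0≤n*-a⇒n≡0 (+ suc _) (suc _) _ ()

0≤a+n*-a⇒n≤1 : ∀ a n → + 0 < a → + 0 ≤ a + + n * - a → n N.≤ 1
0≤a+n*-a⇒n≤1 a zero _ _ = z≤n
0≤a+n*-a⇒n≤1 a (suc zero) _ _ = s≤s z≤n
0≤a+n*-a⇒n≤1 (+ zero) (suc (suc n)) (+<+ ()) _
0≤a+n*-a⇒n≤1 (+ suc k) (suc (suc n)) _ h with subst (+ 0 ≤_) (expand (+ suc k) (+ n)) h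
  where
  expand : ∀ a m → a + (+ 1 + (+ 1 + m)) * (- a) ≡ - ((+ 1 + m) * a)
  expand = solve-∀
... | ()

n*-a≡0⇒n≡0 : ∀ a n → a ≢ + 0 → + n * - a ≡ + 0 → n ≡ 0
n*-a≡0⇒n≡0 a n a≢0 e with ZP.i*j≡0⇒i≡0∨j≡0 (+ n) e
... | inj₁ n≡0 = ZP.+-injective n≡0
... | inj₂ -a≡0 = ⊥-elim (a≢0 (ZP.neg-injective -a≡0))

a+n*-a≡0⇒n≡1 : ∀ a n → a ≢ + 0 → a + + n * - a ≡ + 0 → n ≡ 1
a+n*-a≡0⇒n≡1 a zero a≢0 e = ⊥-elim (a≢0 (trans (expand a) e))
  where
  expand : ∀ a → a ≡ a + + 0 * - a
  expand = solve-∀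
a+n*-a≡0⇒n≡1 a (suc n) a≢0 e with ZP.i*j≡0⇒i≡0∨j≡0 (+ n) (ZP.neg-injective (trans (sym (expand a (+ n))) e))
  where
  expand : ∀ a m → a + (+ 1 + m) * (- a) ≡ - (m * a)
  expand = solve-∀
... | inj₁ n≡0 = cong suc (ZP.+-injective n≡0)
... | inj₂ a≡0 = ⊥-elim (a≢0 a≡0)

-- Faces as minimisers of weighted distances

module _ {d} {F : VSet d} (fF : IsFace F) where

  normal : Vec ℤ d
  normal = proj₁ fF

  height : ℤ
  height = proj₁ (proj₂ fF)

  face-bound : ∀ v → HVert v → dot normal v ≤ height
  face-bound = proj₁ (proj₂ (proj₂ fF))

  face⇒level : ∀ v → F v → HVert v × dot normal v ≡ height
  face⇒level v = proj₁ (proj₂ (proj₂ (proj₂ fF)) v)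

  level⇒face : ∀ v → HVert v → dot normal v ≡ height → F v
  level⇒face v hv e = proj₂ (proj₂ (proj₂ (proj₂ fF)) v) (hv , e)

IsFace-resp-≈ : ∀ {d} {F G : VSet d} → F ≈ G → IsFace F → IsFace G
IsFace-resp-≈ (F⊆G , G⊆F) (c , m , bound , level) =
  c , m , bound , λ v → proj₁ (level v) ∘ G⊆F v , F⊆G v ∘ proj₂ (level v)

-- A weighted Hamming distance from u is affine in x, so its minimisers over H_d form a face.
wdist : ∀ {d} → Vec ℕ d → Pt d → Pt d → ℕ
wdist [] [] [] = 0
wdist (w ∷ ws) (a ∷ u) (b ∷ x) = (if a xor b then w else 0) N.+ wdist ws u x

wdistNormal : ∀ {d} → Vec ℕ d → Pt d → Vec ℤ d
wdistNormal [] [] = []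
wdistNormal (w ∷ ws) (a ∷ u) = (if a then + w else - + w) ∷ wdistNormal ws u

wdistOffset : ∀ {d} → Vec ℕ d → Pt d → ℕ
wdistOffset [] [] = 0
wdistOffset (w ∷ ws) (a ∷ u) = (if a then w else 0) N.+ wdistOffset ws u

dot-wdistNormal : ∀ {d} (w : Vec ℕ d) u x → dot (wdistNormal w u) x + + wdist w u x ≡ + wdistOffset w u
dot-wdistNormal [] [] [] = refl
dot-wdistNormal (w ∷ ws) (a ∷ u) (b ∷ x) = begin
  (c * coord b + dot cs x) + + (t N.+ wdist ws u x)  ≡⟨ cong (_+_ (c * coord b + dot cs x)) (ZP.pos-+ t _) ⟩
  (c * coord b + dot cs x) + (+ t + + wdist ws u x)  ≡⟨ ℤ-interchange (c * coord b) (dot cs x) (+ t) (+ wdist ws u x) ⟩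
  (c * coord b + + t) + (dot cs x + + wdist ws u x)  ≡⟨ cong₂ _+_ (coordinate a b) (dot-wdistNormal ws u x) ⟩
  + o + + wdistOffset ws u                           ≡⟨ ZP.pos-+ o _ ⟨
  + (o N.+ wdistOffset ws u)                         ∎
  where
  open ≡-Reasoning
  c = if a then + w else - + w
  cs = wdistNormal ws u
  t = if a xor b then w else 0
  o = if a then w else 0
  coordinate : ∀ a b → (if a then + w else - + w) * coord b + + (if a xor b then w else 0) ≡ + (if a then w else 0)
  coordinate true true = trans (ZP.+-identityʳ _) (ZP.*-identityʳ (+ w))
  coordinate true false = trans (cong (_+ + w) (ZP.*-zeroʳ (+ w))) (ZP.+-identityˡ (+ w))
  coordinate false true = trans (cong (_+ + w) (ZP.*-identityʳ (- + w))) (ZP.+-inverseˡ (+ w))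
  coordinate false false = trans (ZP.+-identityʳ _) (ZP.*-zeroʳ (- + w))

minWdist-isFace : ∀ {d} (w : Vec ℕ d) u k → (∀ v → HVert v → k N.≤ wdist w u v) →
                  IsFace (λ v → HVert v × wdist w u v ≡ k)
minWdist-isFace w u k bound = wdistNormal w u , + wdistOffset w u - + k , below , λ v → on v , off v
  where
  dot≡ : ∀ v → dot (wdistNormal w u) v ≡ + wdistOffset w u - + wdist w u v
  dot≡ v = i+j≡k⇒i≡k-j _ _ _ (dot-wdistNormal w u v)
  below : ∀ v → HVert v → dot (wdistNormal w u) v ≤ + wdistOffset w u - + k
  below v hv = subst (_≤ _) (sym (dot≡ v))
    (ZP.+-monoʳ-≤ (+ wdistOffset w u) (ZP.neg-mono-≤ (+≤+ (bound v hv))))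
  on : ∀ v → HVert v × wdist w u v ≡ k → HVert v × dot (wdistNormal w u) v ≡ + wdistOffset w u - + k
  on v (hv , e) = hv , trans (dot≡ v) (cong (λ n → + wdistOffset w u - + n) e)
  off : ∀ v → HVert v × dot (wdistNormal w u) v ≡ + wdistOffset w u - + k → HVert v × wdist w u v ≡ k
  off v (hv , e) = hv , ZP.+-injective (ZP.neg-injective (+-cancelˡ (+ wdistOffset w u) _ _ (trans (sym (dot≡ v)) e)))

fixedWeights : ∀ {d} → Pattern d → Vec ℕ d
fixedWeights [] = []
fixedWeights (nothing ∷ σ) = 0 ∷ fixedWeights σ
fixedWeights (just _ ∷ σ) = 1 ∷ fixedWeights σ

fixedWdist≡0⇒Matches : ∀ {d} (σ : Pattern d) x → wdist (fixedWeights σ) (basePoint σ) x ≡ 0 → Matches σ x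
fixedWdist≡0⇒Matches [] [] e = tt
fixedWdist≡0⇒Matches (nothing ∷ σ) (true ∷ x) e = fixedWdist≡0⇒Matches σ x e
fixedWdist≡0⇒Matches (nothing ∷ σ) (false ∷ x) e = fixedWdist≡0⇒Matches σ x e
fixedWdist≡0⇒Matches (just a ∷ σ) (b ∷ x) e with a xor b in eq
... | false = xor≡false⇒≡ a b eq , fixedWdist≡0⇒Matches σ x e

Matches⇒fixedWdist≡0 : ∀ {d} (σ : Pattern d) x → Matches σ x → wdist (fixedWeights σ) (basePoint σ) x ≡ 0
Matches⇒fixedWdist≡0 [] [] _ = refl
Matches⇒fixedWdist≡0 (nothing ∷ σ) (false ∷ x) m = Matches⇒fixedWdist≡0 σ x m
Matches⇒fixedWdist≡0 (nothing ∷ σ) (true ∷ x) m = Matches⇒fixedWdist≡0 σ x m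
Matches⇒fixedWdist≡0 (just a ∷ σ) (.a ∷ x) (refl , m) rewrite BP.xor-same a = Matches⇒fixedWdist≡0 σ x m

Half-isFace : ∀ {d} (σ : Pattern d) → IsFace (Half σ)
Half-isFace σ = IsFace-resp-≈
  ((λ v (hv , e) → hv , fixedWdist≡0⇒Matches σ v e) , (λ v (hv , m) → hv , Matches⇒fixedWdist≡0 σ v m))
  (minWdist-isFace (fixedWeights σ) (basePoint σ) 0 (λ _ _ → z≤n))

-- With weight 2 on the fixed coordinates, weighted distance 1 from u means a neighbour of u in Half σ.
cornerWeights : ∀ {d} → Pattern d → Vec ℕ d
cornerWeights [] = []
cornerWeights (nothing ∷ σ) = 1 ∷ cornerWeights σ
cornerWeights (just _ ∷ σ) = 2 ∷ cornerWeights σ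

cornerWdist≡0⇒≡ : ∀ {d} (σ : Pattern d) u x → wdist (cornerWeights σ) u x ≡ 0 → u ≡ x
cornerWdist≡0⇒≡ [] [] [] e = refl
cornerWdist≡0⇒≡ (nothing ∷ σ) (a ∷ u) (b ∷ x) e with a xor b in eq
... | false = cong₂ _∷_ (xor≡false⇒≡ a b eq) (cornerWdist≡0⇒≡ σ u x e)
cornerWdist≡0⇒≡ (just _ ∷ σ) (a ∷ u) (b ∷ x) e with a xor b in eq
... | false = cong₂ _∷_ (xor≡false⇒≡ a b eq) (cornerWdist≡0⇒≡ σ u x e)

cornerWdist-self : ∀ {d} (σ : Pattern d) u → wdist (cornerWeights σ) u u ≡ 0
cornerWdist-self [] [] = refl
cornerWdist-self (nothing ∷ σ) (a ∷ u) rewrite BP.xor-same a = cornerWdist-self σ u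
cornerWdist-self (just _ ∷ σ) (a ∷ u) rewrite BP.xor-same a = cornerWdist-self σ u

cornerWdist≡1⇒ : ∀ {d} (σ : Pattern d) u x → Matches σ u → wdist (cornerWeights σ) u x ≡ 1 →
                 Matches σ x × dist u x ≡ 1
cornerWdist≡1⇒ [] [] [] _ ()
cornerWdist≡1⇒ (nothing ∷ σ) (a ∷ u) (b ∷ x) mu e with a xor b in eq
... | false = cornerWdist≡1⇒ σ u x mu e
... | true rewrite sym (cornerWdist≡0⇒≡ σ u x (NP.suc-injective e)) = mu , cong suc (dist-self u)
cornerWdist≡1⇒ (just c ∷ σ) (.c ∷ u) (b ∷ x) (refl , mu) e with c xor b in eq
... | false = (xor≡false⇒≡ c b eq , proj₁ (cornerWdist≡1⇒ σ u x mu e)) , proj₂ (cornerWdist≡1⇒ σ u x mu e)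

⇒cornerWdist≡1 : ∀ {d} (σ : Pattern d) u x → Matches σ u → Matches σ x → dist u x ≡ 1 →
                 wdist (cornerWeights σ) u x ≡ 1
⇒cornerWdist≡1 [] [] [] _ _ ()
⇒cornerWdist≡1 (nothing ∷ σ) (a ∷ u) (b ∷ x) mu mx e with a xor b
... | false = ⇒cornerWdist≡1 σ u x mu mx e
... | true rewrite sym (dist≡0⇒≡ u x (NP.suc-injective e)) = cong suc (cornerWdist-self σ u)
⇒cornerWdist≡1 (just c ∷ σ) (.c ∷ u) (.c ∷ x) (refl , mu) (refl , mx) e rewrite BP.xor-same c =
  ⇒cornerWdist≡1 σ u x mu mx e

Corner-isFace : ∀ {d} (σ : Pattern d) u → Matches σ u → parity u ≡ true → IsFace (Corner σ u)
Corner-isFace σ u mu odd = IsFace-resp-≈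
  ( (λ v (hv , e) → (hv , proj₁ (cornerWdist≡1⇒ σ u v mu e)) , proj₂ (cornerWdist≡1⇒ σ u v mu e))
  , (λ v ((hv , mv) , e) → hv , ⇒cornerWdist≡1 σ u v mu mv e))
  (minWdist-isFace (cornerWeights σ) u 1 positive)
  where
  positive : ∀ v → HVert v → 1 N.≤ wdist (cornerWeights σ) u v
  positive v hv with wdist (cornerWeights σ) u v in eq
  ... | suc _ = s≤s z≤n
  ... | zero with () ← trans (sym odd) (trans (cong parity (cornerWdist≡0⇒≡ σ u v eq)) (HVert⇒even v hv))

-- Gains of a linear functional

sign : Bool → ℤ
sign true = -[1+ 0 ]
sign false = + 1

-- gain c x j is the change of c · x when coordinate j of x is toggled.
gain : ∀ {d} → Vec ℤ d → Pt d → Fin d → ℤ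
gain c x j = lookup c j * sign (lookup x j)

Δ : ∀ {d} → Vec ℤ d → Pt d → Pt d → ℤ
Δ [] [] [] = + 0
Δ (c ∷ cs) (a ∷ x) (b ∷ y) = (if a xor b then c * sign a else + 0) + Δ cs x y

dot-Δ : ∀ {d} (c : Vec ℤ d) x y → dot c y ≡ dot c x + Δ c x y
dot-Δ [] [] [] = refl
dot-Δ (c ∷ cs) (a ∷ x) (b ∷ y) = begin
  c * coord b + dot cs y                  ≡⟨ cong₂ _+_ (coordinate a b) (dot-Δ cs x y) ⟩
  (c * coord a + t) + (dot cs x + Δ cs x y) ≡⟨ ℤ-interchange (c * coord a) t (dot cs x) (Δ cs x y) ⟩
  (c * coord a + dot cs x) + (t + Δ cs x y) ∎
  where
  open ≡-Reasoning
  t = if a xor b then c * sign a else + 0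
  coordinate : ∀ a b → c * coord b ≡ c * coord a + (if a xor b then c * sign a else + 0)
  coordinate true true = sym (ZP.+-identityʳ _)
  coordinate false false = sym (ZP.+-identityʳ _)
  coordinate true false = down c
    where
    down : ∀ c → c * + 0 ≡ c * + 1 + c * -[1+ 0 ]
    down = solve-∀
  coordinate false true = up c
    where
    up : ∀ c → c * + 1 ≡ c * + 0 + c * + 1
    up = solve-∀

Δ-self : ∀ {d} (c : Vec ℤ d) x → Δ c x x ≡ + 0
Δ-self [] [] = refl
Δ-self (c ∷ cs) (a ∷ x) rewrite BP.xor-same a = trans (ZP.+-identityˡ _) (Δ-self cs x)

Δ-toggle : ∀ {d} (c : Vec ℤ d) x j → Δ c x (toggle x j) ≡ gain c x j
Δ-toggle (c ∷ cs) (a ∷ x) zero rewrite BP.xor-inverseʳ a | Δ-self cs x = ZP.+-identityʳ _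
Δ-toggle (c ∷ cs) (a ∷ x) (suc j) rewrite BP.xor-same a = trans (ZP.+-identityˡ _) (Δ-toggle cs x j)

dot-toggle : ∀ {d} (c : Vec ℤ d) x j → dot c (toggle x j) ≡ dot c x + gain c x j
dot-toggle c x j = trans (dot-Δ c x (toggle x j)) (cong (_+_ (dot c x)) (Δ-toggle c x j))

gain-toggle-other : ∀ {d} (c : Vec ℤ d) x j l → l ≢ j → gain c (toggle x j) l ≡ gain c x l
gain-toggle-other c x j l l≢j = cong (λ b → lookup c l * sign b) (lookup-toggle-other x j l l≢j)

e+n*e≡[1+n]*e : ∀ e n → e + + n * e ≡ + suc n * e
e+n*e≡[1+n]*e e n = distrib e (+ n)
  where
  distrib : ∀ e m → e + m * e ≡ (+ 1 + m) * e
  distrib = solve-∀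

Δ≤dist* : ∀ {d} (c : Vec ℤ d) x y e → (∀ j → Differ x y j → gain c x j ≤ e) → Δ c x y ≤ + dist x y * e
Δ≤dist* [] [] [] e bound = ZP.≤-refl
Δ≤dist* (c ∷ cs) (a ∷ x) (b ∷ y) e bound with a xor b in eq
... | true = subst (c * sign a + Δ cs x y ≤_) (e+n*e≡[1+n]*e e (dist x y))
               (ZP.+-mono-≤ (bound zero eq) (Δ≤dist* cs x y e (bound ∘ suc)))
... | false = subst (_≤ + dist x y * e) (sym (ZP.+-identityˡ _)) (Δ≤dist* cs x y e (bound ∘ suc))

dist*≤Δ : ∀ {d} (c : Vec ℤ d) x y e → (∀ j → Differ x y j → e ≤ gain c x j) → + dist x y * e ≤ Δ c x y
dist*≤Δ [] [] [] e bound = ZP.≤-refl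
dist*≤Δ (c ∷ cs) (a ∷ x) (b ∷ y) e bound with a xor b in eq
... | true = subst (_≤ c * sign a + Δ cs x y) (e+n*e≡[1+n]*e e (dist x y))
               (ZP.+-mono-≤ (bound zero eq) (dist*≤Δ cs x y e (bound ∘ suc)))
... | false = subst (+ dist x y * e ≤_) (sym (ZP.+-identityˡ _)) (dist*≤Δ cs x y e (bound ∘ suc))

Δ≤0 : ∀ {d} (c : Vec ℤ d) x y → (∀ j → Differ x y j → gain c x j ≤ + 0) → Δ c x y ≤ + 0
Δ≤0 c x y nonpos = subst (Δ c x y ≤_) (ZP.*-zeroʳ (+ dist x y)) (Δ≤dist* c x y (+ 0) nonpos)

Δ≡0 : ∀ {d} (c : Vec ℤ d) x y → (∀ j → Differ x y j → gain c x j ≡ + 0) → Δ c x y ≡ + 0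
Δ≡0 c x y zeros = ZP.≤-antisym (Δ≤0 c x y (λ j → ZP.≤-reflexive ∘ zeros j))
  (subst (_≤ Δ c x y) (ZP.*-zeroʳ (+ dist x y)) (dist*≤Δ c x y (+ 0) (λ j → ZP.≤-reflexive ∘ sym ∘ zeros j)))

Δ≡0⇒gain≡0 : ∀ {d} (c : Vec ℤ d) x y → (∀ j → Differ x y j → gain c x j ≤ + 0) → Δ c x y ≡ + 0 →
             ∀ j → Differ x y j → gain c x j ≡ + 0
Δ≡0⇒gain≡0 (c ∷ cs) (a ∷ x) (b ∷ y) nonpos e j dj with a xor b in eq
... | false = rest j dj
  where
  rest : ∀ j → Differ (a ∷ x) (b ∷ y) j → gain (c ∷ cs) (a ∷ x) j ≡ + 0
  rest zero dj with () ← trans (sym eq) dj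
  rest (suc j) dj = Δ≡0⇒gain≡0 cs x y (nonpos ∘ suc) (trans (sym (ZP.+-identityˡ _)) e) j dj
... | true = rest j dj
  where
  head≡0 : c * sign a ≡ + 0
  head≡0 = nonpos+nonpos≡0⇒≡0 _ _ (nonpos zero eq) (Δ≤0 cs x y (nonpos ∘ suc)) e
  rest : ∀ j → Differ (a ∷ x) (b ∷ y) j → gain (c ∷ cs) (a ∷ x) j ≡ + 0
  rest zero dj = head≡0
  rest (suc j) dj = Δ≡0⇒gain≡0 cs x y (nonpos ∘ suc)
    (trans (sym (ZP.+-identityˡ _)) (trans (cong (_+ Δ cs x y) (sym head≡0)) e)) j dj

distExcept : ∀ {d} → Pt d → Pt d → Fin d → ℕ
distExcept (a ∷ x) (b ∷ y) zero = dist x y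
distExcept (a ∷ x) (b ∷ y) (suc k) = bit (a xor b) N.+ distExcept x y k

Δat : ∀ {d} → Vec ℤ d → Pt d → Pt d → Fin d → ℤ
Δat c x y k = if lookup x k xor lookup y k then gain c x k else + 0

dist-split : ∀ {d} (x y : Pt d) k → dist x y ≡ bit (lookup x k xor lookup y k) N.+ distExcept x y k
dist-split (a ∷ x) (b ∷ y) zero = refl
dist-split (a ∷ x) (b ∷ y) (suc k) =
  trans (cong (bit (a xor b) N.+_) (dist-split x y k)) (+-lcomm (bit (a xor b)) _ (distExcept x y k))

dist-toggle-split : ∀ {d} (x y : Pt d) k →
                    dist (toggle x k) y ≡ bit (not (lookup x k xor lookup y k)) N.+ distExcept x y k
dist-toggle-split (a ∷ x) (b ∷ y) zero = cong (λ t → bit t N.+ dist x y) (sym (BP.not-distribˡ-xor a b))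
dist-toggle-split (a ∷ x) (b ∷ y) (suc k) =
  trans (cong (bit (a xor b) N.+_) (dist-toggle-split x y k)) (+-lcomm (bit (a xor b)) _ (distExcept x y k))

e+[t+n*e]≡t+[1+n]*e : ∀ e t n → e + (t + + n * e) ≡ t + + suc n * e
e+[t+n*e]≡t+[1+n]*e e t n = distrib e t (+ n)
  where
  distrib : ∀ e t m → e + (t + m * e) ≡ t + (+ 1 + m) * e
  distrib = solve-∀

Δ≤Δat+distExcept* : ∀ {d} (c : Vec ℤ d) x y k e → (∀ j → j ≢ k → Differ x y j → gain c x j ≤ e) →
                    Δ c x y ≤ Δat c x y k + + distExcept x y k * e
Δ≤Δat+distExcept* (c ∷ cs) (a ∷ x) (b ∷ y) zero e bound =
  ZP.+-monoʳ-≤ (if a xor b then c * sign a else + 0) (Δ≤dist* cs x y e (λ j → bound (suc j) λ ()))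
Δ≤Δat+distExcept* (c ∷ cs) (a ∷ x) (b ∷ y) (suc k) e bound with a xor b in eq
... | true = subst (c * sign a + Δ cs x y ≤_) (e+[t+n*e]≡t+[1+n]*e e (Δat cs x y k) (distExcept x y k))
               (ZP.+-mono-≤ (bound zero (λ ()) eq)
                            (Δ≤Δat+distExcept* cs x y k e (λ j j≢k → bound (suc j) (j≢k ∘ FP.suc-injective))))
... | false = subst (_≤ Δat cs x y k + + distExcept x y k * e) (sym (ZP.+-identityˡ _))
               (Δ≤Δat+distExcept* cs x y k e (λ j j≢k → bound (suc j) (j≢k ∘ FP.suc-injective)))

Δat+distExcept*≤Δ : ∀ {d} (c : Vec ℤ d) x y k e → (∀ j → j ≢ k → Differ x y j → e ≤ gain c x j) →
                    Δat c x y k + + distExcept x y k * e ≤ Δ c x y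
Δat+distExcept*≤Δ (c ∷ cs) (a ∷ x) (b ∷ y) zero e bound =
  ZP.+-monoʳ-≤ (if a xor b then c * sign a else + 0) (dist*≤Δ cs x y e (λ j → bound (suc j) λ ()))
Δat+distExcept*≤Δ (c ∷ cs) (a ∷ x) (b ∷ y) (suc k) e bound with a xor b in eq
... | true = subst (_≤ c * sign a + Δ cs x y) (e+[t+n*e]≡t+[1+n]*e e (Δat cs x y k) (distExcept x y k))
               (ZP.+-mono-≤ (bound zero (λ ()) eq)
                            (Δat+distExcept*≤Δ cs x y k e (λ j j≢k → bound (suc j) (j≢k ∘ FP.suc-injective))))
... | false = subst (Δat cs x y k + + distExcept x y k * e ≤_) (sym (ZP.+-identityˡ _))
               (Δat+distExcept*≤Δ cs x y k e (λ j j≢k → bound (suc j) (j≢k ∘ FP.suc-injective)))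

Δ-constGains : ∀ {d} (c : Vec ℤ d) x y k e → (∀ j → j ≢ k → Differ x y j → gain c x j ≡ e) →
               Δ c x y ≡ Δat c x y k + + distExcept x y k * e
Δ-constGains c x y k e const = ZP.≤-antisym
  (Δ≤Δat+distExcept* c x y k e (λ j j≢k → ZP.≤-reflexive ∘ const j j≢k))
  (Δat+distExcept*≤Δ c x y k e (λ j j≢k → ZP.≤-reflexive ∘ sym ∘ const j j≢k))

Δat-differ : ∀ {d} (c : Vec ℤ d) x y k → Differ x y k → Δat c x y k ≡ gain c x k
Δat-differ c x y k dk rewrite dk = refl

Δat-agree : ∀ {d} (c : Vec ℤ d) x y k → lookup x k xor lookup y k ≡ false → Δat c x y k ≡ + 0
Δat-agree c x y k dk rewrite dk = refl

dot-toggle₂ : ∀ {d} (c : Vec ℤ d) x j l → l ≢ j → dot c (toggle₂ x j l) ≡ dot c x + (gain c x j + gain c x l)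
dot-toggle₂ c x j l l≢j = begin
  dot c (toggle (toggle x j) l)                   ≡⟨ dot-toggle c (toggle x j) l ⟩
  dot c (toggle x j) + gain c (toggle x j) l      ≡⟨ cong₂ _+_ (dot-toggle c x j) (gain-toggle-other c x j l l≢j) ⟩
  (dot c x + gain c x j) + gain c x l             ≡⟨ ZP.+-assoc (dot c x) (gain c x j) (gain c x l) ⟩
  dot c x + (gain c x j + gain c x l)             ∎
  where open ≡-Reasoning

module _ {d} {K : VSet d} (fK : IsFace K) where

  Δ-face : ∀ {x y} → K x → K y → Δ (normal fK) x y ≡ + 0
  Δ-face {x} {y} kx ky = i+j≡i⇒j≡0 (dot (normal fK) x) _
    (trans (sym (dot-Δ (normal fK) x y)) (trans (proj₂ (face⇒level fK y ky)) (sym (proj₂ (face⇒level fK x kx)))))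

  gain-pair≡0 : ∀ {x} j l → l ≢ j → K x → K (toggle₂ x j l) → gain (normal fK) x j + gain (normal fK) x l ≡ + 0
  gain-pair≡0 {x} j l l≢j kx ky = i+j≡i⇒j≡0 (dot (normal fK) x) _
    (trans (sym (dot-toggle₂ (normal fK) x j l l≢j))
      (trans (proj₂ (face⇒level fK _ ky)) (sym (proj₂ (face⇒level fK x kx)))))

  gain-pair≤0 : ∀ {x} j l → l ≢ j → K x → HVert (toggle₂ x j l) →
                gain (normal fK) x j + gain (normal fK) x l ≤ + 0
  gain-pair≤0 {x} j l l≢j kx hy = i+j≤i⇒j≤0 (dot (normal fK) x) _
    (subst₂ _≤_ (dot-toggle₂ (normal fK) x j l l≢j) (sym (proj₂ (face⇒level fK x kx)))
      (face-bound fK _ hy))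

  gains≡0⇒Half⊆ : ∀ σ x → Half σ x → K x → (∀ j → Free σ j → gain (normal fK) x j ≡ + 0) → Half σ ⊆ K
  gains≡0⇒Half⊆ σ x (_ , mx) kx zeros y (hy , my) = level⇒face fK y hy (begin
    dot (normal fK) y                     ≡⟨ dot-Δ (normal fK) x y ⟩
    dot (normal fK) x + Δ (normal fK) x y  ≡⟨ cong (_+_ (dot (normal fK) x)) (Δ≡0 (normal fK) x y zeros′) ⟩
    dot (normal fK) x + + 0               ≡⟨ ZP.+-identityʳ _ ⟩
    dot (normal fK) x                     ≡⟨ proj₂ (face⇒level fK x kx) ⟩
    height fK                             ∎)
    where
    open ≡-Reasoning
    zeros′ : ∀ j → Differ x y j → gain (normal fK) x j ≡ + 0
    zeros′ j = zeros j ∘ Differ⇒Free σ x y j mx my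

-- Facets of a sub-halfcube

toggle-dist≡1 : ∀ {d} (x y : Pt d) k → (lookup x k xor lookup y k ≡ false → distExcept x y k ≡ 0) →
                (Differ x y k → distExcept x y k ≡ 1) → dist (toggle x k) y ≡ 1
toggle-dist≡1 x y k agree differ with lookup x k xor lookup y k in dk
... | false = trans (cong (dist (toggle x k)) y≡x) (trans (dist-sym (toggle x k) x) (dist-toggle x k))
  where
  y≡x : y ≡ x
  y≡x = sym (dist≡0⇒≡ x y (trans (dist-split x y k) (cong₂ N._+_ (cong bit dk) (agree refl))))
... | true = trans (dist-toggle-split x y k) (cong₂ (λ t n → bit (not t) N.+ n) dk (differ refl))

all≡0-split : ∀ {d} (P : Fin d → Set) (f : Fin d → ℤ) j →
              f j ≡ + 0 → (∀ l → P l → l ≢ j → f l ≡ + 0) →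
              ∀ l → P l → f l ≡ + 0
all≡0-split P f j fj≡0 others l pl with l FP.≟ j
... | yes refl = fj≡0
... | no l≢j = others l pl l≢j

module _ {d} {G : VSet d} (fG : IsFace G) (σ : Pattern d) (G⊆H : G ⊆ Half σ) {x} (gx : G x) where

  private
    c = normal fG
    hx = G⊆H x gx
    Δat-agree≡ : ∀ {y} k e → lookup x k xor lookup y k ≡ false →
                 Δat c x y k + + distExcept x y k * e ≡ + distExcept x y k * e
    Δat-agree≡ {y} k e dk = trans (cong (_+ + distExcept x y k * e) (Δat-agree c x y k dk)) (ZP.+-identityˡ _)

  positiveGain⇒⊆Corner : ∀ k → Free σ k → + 0 < gain c x k → G ⊆ Corner σ (toggle x k)
  positiveGain⇒⊆Corner k fk pos y gy = hy , toggle-dist≡1 x y k agree differ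
    where
    a = gain c x k
    hy = G⊆H y gy
    othersBelow : ∀ j → j ≢ k → Differ x y j → gain c x j ≤ - a
    othersBelow j j≢k dj = i+j≤0⇒j≤-i a _ (gain-pair≤0 fG k j j≢k gx
      (proj₁ (Half-toggle₂ σ x k j fk (Differ⇒Free σ x y j (proj₂ hx) (proj₂ hy) dj) hx)))
    0≤Δ : + 0 ≤ Δat c x y k + + distExcept x y k * - a
    0≤Δ = subst (_≤ Δat c x y k + + distExcept x y k * - a) (Δ-face fG gx gy)
                (Δ≤Δat+distExcept* c x y k (- a) othersBelow)
    agree : lookup x k xor lookup y k ≡ false → distExcept x y k ≡ 0
    agree dk = 0≤n*-a⇒n≡0 a _ pos (subst (+ 0 ≤_) (Δat-agree≡ k (- a) dk) 0≤Δ)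
    n≤1 : Differ x y k → distExcept x y k N.≤ 1
    n≤1 dk = 0≤a+n*-a⇒n≤1 a _ pos (subst (+ 0 ≤_) (cong (_+ + distExcept x y k * - a) (Δat-differ c x y k dk)) 0≤Δ)
    differ : Differ x y k → distExcept x y k ≡ 1
    differ dk with distExcept x y k in n≡ | n≤1 dk
    ... | 1 | _ = refl
    ... | suc (suc _) | s≤s ()
    -- dist x y = 1 would contradict the parity of x and y
    ... | 0 | _ with () ← trans (sym (cong oddᵇ (trans (dist-split x y k) (cong₂ N._+_ (cong bit dk) n≡))))
                                 (dist-even x y (proj₁ hx) (proj₁ hy))

  oppositeGains⇒⊆Corner : ∀ k → gain c x k ≢ + 0 → (∀ j → Free σ j → j ≢ k → gain c x j ≡ - gain c x k) →
                          G ⊆ Corner σ (toggle x k)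
  oppositeGains⇒⊆Corner k a≢0 opposite y gy = hy , toggle-dist≡1 x y k agree differ
    where
    a = gain c x k
    hy = G⊆H y gy
    0≡Δ : + 0 ≡ Δat c x y k + + distExcept x y k * - a
    0≡Δ = trans (sym (Δ-face fG gx gy))
      (Δ-constGains c x y k (- a) λ j j≢k dj → opposite j (Differ⇒Free σ x y j (proj₂ hx) (proj₂ hy) dj) j≢k)
    agree : lookup x k xor lookup y k ≡ false → distExcept x y k ≡ 0
    agree dk = n*-a≡0⇒n≡0 a _ a≢0 (sym (trans 0≡Δ (Δat-agree≡ k (- a) dk)))
    differ : Differ x y k → distExcept x y k ≡ 1
    differ dk = a+n*-a≡0⇒n≡1 a _ a≢0 (sym (trans 0≡Δ (cong (_+ + distExcept x y k * - a) (Δat-differ c x y k dk))))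

  nonpositiveGains⇒⊆fix : (∀ j → Free σ j → gain c x j ≤ + 0) → ∀ j → gain c x j < + 0 →
                          G ⊆ Half (fix σ j (lookup x j))
  nonpositiveGains⇒⊆fix nonpos j neg y gy with G⊆H y gy | lookup x j xor lookup y j in dj
  ... | hy , my | false = hy , Matches-fix⁺ σ j _ y my (sym (xor≡false⇒≡ _ _ dj))
  ... | hy , my | true = ⊥-elim (ZP.<-irrefl
    (Δ≡0⇒gain≡0 c x y (λ l dl → nonpos l (Differ⇒Free σ x y l (proj₂ hx) my dl)) (Δ-face fG gx gy) j dj) neg)

  otherGains≡0⇒⊆fix : ∀ j b → lookup x j ≡ b → gain c x j ≢ + 0 →
                      (∀ l → Free σ l → l ≢ j → gain c x l ≡ + 0) →
                      G ⊆ Half (fix σ j b)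
  otherGains≡0⇒⊆fix j b xj≡b gj≢0 others y gy with G⊆H y gy | lookup x j xor lookup y j in dj
  ... | hy , my | false = hy , Matches-fix⁺ σ j b y my (trans (sym (xor≡false⇒≡ _ _ dj)) xj≡b)
  ... | hy , my | true = ⊥-elim (gj≢0 (begin
    gain c x j                                 ≡⟨ ZP.+-identityʳ _ ⟨
    gain c x j + + 0                           ≡⟨ cong₂ _+_ (Δat-differ c x y j dj) (ZP.*-zeroʳ (+ distExcept x y j)) ⟨
    Δat c x y j + + distExcept x y j * + 0     ≡⟨ Δ-constGains c x y j (+ 0) others′ ⟨
    Δ c x y                                    ≡⟨ Δ-face fG gx gy ⟩
    + 0                                        ∎))
    where
    open ≡-Reasoning
    others′ : ∀ l → l ≢ j → Differ x y l → gain c x l ≡ + 0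
    others′ l l≢j dl = others l (Differ⇒Free σ x y l (proj₂ hx) my dl) l≢j

fix-otherGains≡0 : ∀ {d} {K : VSet d} (fK : IsFace K) σ j b → Free σ j → 3 N.≤ #free (fix σ j b) →
                   Half (fix σ j b) ⊆ K → ∀ {x} → Half (fix σ j b) x →
                   ∀ l → Free σ l → l ≢ j → gain (normal fK) x l ≡ + 0
fix-otherGains≡0 fK σ j b fj h3 H′⊆K {x} hx l fl l≢j
  with p , fp , p≢l ∷ [] ← freeOutside (fix σ j b) (l ∷ []) (NP.<⇒≤ h3)
  with q , fq , q≢l ∷ q≢p ∷ [] ← freeOutside (fix σ j b) (l ∷ p ∷ []) h3
  = pairwise+≡0⇒≡0 _ _ _ (pair l p fl′ fp p≢l) (pair l q fl′ fq q≢l) (pair p q fp fq q≢p)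
  where
  fl′ = Free-fix⁺ σ j b l l≢j fl
  pair : ∀ s t → Free (fix σ j b) s → Free (fix σ j b) t → t ≢ s → gain (normal fK) x s + gain (normal fK) x t ≡ + 0
  pair s t fs ft t≢s = gain-pair≡0 fK s t t≢s (H′⊆K x hx) (H′⊆K _ (Half-toggle₂ (fix σ j b) x s t fs ft hx))

fix-isFacet : ∀ {d} (σ : Pattern d) j b → Free σ j → 4 N.≤ #free σ → IsFacetOf (Half (fix σ j b)) (Half σ)
fix-isFacet {d} σ j b fj h4 =
  Half-isFace σ′ , fix⊆Half σ j b fj , Half⊈fix σ j b fj (NP.<⇒≤ (NP.<⇒≤ h4)) , maximal
  where
  σ′ = fix σ j b
  h3 : 3 N.≤ #free σ′
  h3 = NP.≤-pred (subst (4 N.≤_) (sym (#free-fix σ j b fj)) h4)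
  maximal : (K : VSet d) → IsFace K → Half σ′ ⊆ K → K ⊆ Half σ → K ≈ Half σ′ ⊎ K ≈ Half σ
  maximal K fK H′⊆K K⊆H
    with x , hx ← Half-nonempty σ′ (NP.<⇒≤ (NP.<⇒≤ h3))
    with gain (normal fK) x j ZP.≟ + 0
  ... | yes gj≡0 = inj₂ (K⊆H , gains≡0⇒Half⊆ fK σ x (K⊆H x (H′⊆K x hx)) (H′⊆K x hx)
                                (all≡0-split (Free σ) (gain (normal fK) x) j gj≡0 others))
    where others = fix-otherGains≡0 fK σ j b fj h3 H′⊆K hx
  ... | no gj≢0 = inj₁ (otherGains≡0⇒⊆fix fK σ K⊆H (H′⊆K x hx) j b xj≡b gj≢0 others , H′⊆K)
    where
    others = fix-otherGains≡0 fK σ j b fj h3 H′⊆K hx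
    xj≡b = proj₂ (Matches-fix⁻ σ j b x fj (proj₂ hx))

-- Toggling k and then j in toggle u k gives toggle u j, again a corner point, so the two gains cancel.
Corner-oppositeGains : ∀ {d} {K : VSet d} (fK : IsFace K) σ u → Matches σ u → parity u ≡ true →
                       Corner σ u ⊆ K → ∀ k → Free σ k → let x = toggle u k in
                       ∀ j → Free σ j → j ≢ k → gain (normal fK) x j ≡ - gain (normal fK) x k
Corner-oppositeGains fK σ u mu odd C⊆K k fk j fj j≢k = i+j≡0⇒j≡-i _ _ (gain-pair≡0 fK k j j≢k
  (C⊆K _ (toggle∈Corner σ u mu odd k fk))
  (C⊆K _ (subst (λ z → Corner σ u (toggle z j)) (sym (toggle-involutive u k)) (toggle∈Corner σ u mu odd j fj))))

Corner-isFacet : ∀ {d} (σ : Pattern d) u → Matches σ u → parity u ≡ true → 3 N.≤ #free σ →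
                 IsFacetOf (Corner σ u) (Half σ)
Corner-isFacet {d} σ u mu odd h3 = Corner-isFace σ u mu odd , (λ _ → proj₁) , Half⊈Corner σ u mu odd h3 , maximal
  where
  maximal : (K : VSet d) → IsFace K → Corner σ u ⊆ K → K ⊆ Half σ → K ≈ Corner σ u ⊎ K ≈ Half σ
  maximal K fK C⊆K K⊆H
    with k , fk , [] ← freeOutside σ [] (NP.<⇒≤ (NP.<⇒≤ h3))
    with gain (normal fK) (toggle u k) k ZP.≟ + 0
  ... | yes a≡0 = inj₂ (K⊆H , gains≡0⇒Half⊆ fK σ (toggle u k) (proj₁ (toggle∈Corner σ u mu odd k fk))
      (C⊆K _ (toggle∈Corner σ u mu odd k fk))
      (all≡0-split (Free σ) _ k a≡0 λ j fj j≢k →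
         trans (Corner-oppositeGains fK σ u mu odd C⊆K k fk j fj j≢k) (cong -_ a≡0)))
  ... | no a≢0 = inj₁ (subst (λ z → K ⊆ Corner σ z) (toggle-involutive u k)
      (oppositeGains⇒⊆Corner fK σ K⊆H (C⊆K _ (toggle∈Corner σ u mu odd k fk)) k a≢0
                             (Corner-oppositeGains fK σ u mu odd C⊆K k fk))
    , C⊆K)

facet-nonempty : ∀ {d} (σ : Pattern d) {G} → 2 N.≤ #free σ → IsFacetOf G (Half σ) → Σ (Pt d) G
facet-nonempty {d} σ {G} h2 (fG , G⊆H , (y , hy , ¬gy) , maximal)
  with ∃Pt? d (λ v → HVert v × dot (normal fG) v ≡ height fG)
              (λ v → HVert? v ×-dec (dot (normal fG) v ZP.≟ height fG))
... | yes (x , hx , ex) = x , level⇒face fG x hx ex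
... | no none = ⊥-elim (impossible (maximal Y (Half-isFace (singletonPattern y)) G⊆Y Y⊆H))
  where
  Y = Half (singletonPattern y)
  G⊆Y : G ⊆ Y
  G⊆Y v gv = ⊥-elim (none (v , face⇒level fG v gv))
  Y⊆H : Y ⊆ Half σ
  Y⊆H v (_ , m) = subst (Half σ) (sym (Matches-singleton⁻ y v m)) hy
  impossible : ¬ (Y ≈ G ⊎ Y ≈ Half σ)
  impossible (inj₁ (Y⊆G , _)) = ¬gy (Y⊆G y (proj₁ hy , Matches-singleton⁺ y))
  impossible (inj₂ (_ , H⊆Y))
    with j , fj , [] ← freeOutside σ [] (NP.<⇒≤ h2)
    with l , fl , l≢j ∷ [] ← freeOutside σ (j ∷ []) h2
    = toggle₂≢ y j l l≢j (Matches-singleton⁻ y _ (proj₂ (H⊆Y _ (Half-toggle₂ σ y j l fj fl hy))))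

FacetShape : ∀ {d} → Pattern d → VSet d → Set
FacetShape {d} σ G = (Σ (Fin d) λ j → Σ Bool λ b → Free σ j × G ≈ Half (fix σ j b))
                   ⊎ (Σ (Pt d) λ u → Matches σ u × parity u ≡ true × G ≈ Corner σ u)

-- Inspect the gains of the facet's normal at one of its vertices x: a positive gain gives a
-- corner facet, otherwise a negative one a coordinate facet; if all vanish, the facet is all of Half σ.
facet-classification : ∀ {d} (σ : Pattern d) G → 3 N.≤ #free σ → IsFacetOf G (Half σ) → FacetShape σ G
facet-classification σ G h3 facet@(fG , G⊆H , (y , hy , ¬gy) , maximal)
  with x , gx ← facet-nonempty σ (NP.<⇒≤ h3) facet
  with FP.any? (λ k → Free? σ k ×-dec (+ 0 ZP.<? gain (normal fG) x k))
... | yes (k , fk , pos) = corner (maximal (Corner σ u) (Corner-isFace σ u mu odd)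
                                     (positiveGain⇒⊆Corner fG σ G⊆H gx k fk pos) (λ _ → proj₁))
  where
  u = toggle x k
  mu = Matches-toggle σ x k fk (proj₂ (G⊆H x gx))
  odd = trans (parity-toggle x k) (cong not (HVert⇒even x (proj₁ (G⊆H x gx))))
  corner : Corner σ u ≈ G ⊎ Corner σ u ≈ Half σ → FacetShape σ G
  corner (inj₁ C≈G) = inj₂ (u , mu , odd , ≈-sym C≈G)
  corner (inj₂ (_ , H⊆C)) with v , hv , ¬cv ← Half⊈Corner σ u mu odd h3 = ⊥-elim (¬cv (H⊆C v hv))
... | no ¬pos with FP.any? (λ j → Free? σ j ×-dec (gain (normal fG) x j ZP.<? + 0))
...   | yes (j , fj , neg) = coordinate (maximal (Half σ′) (Half-isFace σ′)
                                           (nonpositiveGains⇒⊆fix fG σ G⊆H gx nonpos j neg) (fix⊆Half σ j _ fj))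
  where
  nonpos : ∀ j → Free σ j → gain (normal fG) x j ≤ + 0
  nonpos j fj = ZP.≮⇒≥ (λ p → ¬pos (j , fj , p))
  σ′ = fix σ j (lookup x j)
  coordinate : Half σ′ ≈ G ⊎ Half σ′ ≈ Half σ → FacetShape σ G
  coordinate (inj₁ H′≈G) = inj₁ (j , lookup x j , fj , ≈-sym H′≈G)
  coordinate (inj₂ (_ , H⊆H′)) with v , hv , ¬h′v ← Half⊈fix σ j (lookup x j) fj (NP.<⇒≤ h3) =
    ⊥-elim (¬h′v (H⊆H′ v hv))
...   | no ¬neg = ⊥-elim (¬gy (gains≡0⇒Half⊆ fG σ x (G⊆H x gx) gx zeros y hy))
  where
  zeros : ∀ j → Free σ j → gain (normal fG) x j ≡ + 0
  zeros j fj = ZP.≤-antisym (ZP.≮⇒≥ (λ p → ¬pos (j , fj , p))) (ZP.≮⇒≥ (λ p → ¬neg (j , fj , p)))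

-- Affine dependencies and simplices

sumBy : ∀ {A : Set} → (A → ℤ) → List A → ℤ
sumBy f = foldr (λ v acc → f v + acc) (+ 0)

sumBy-++ : ∀ {A : Set} (f : A → ℤ) xs ys → sumBy f (xs ++ ys) ≡ sumBy f xs + sumBy f ys
sumBy-++ f [] ys = sym (ZP.+-identityˡ _)
sumBy-++ f (x ∷ xs) ys = trans (cong (_+_ (f x)) (sumBy-++ f xs ys)) (sym (ZP.+-assoc (f x) _ _))

sumBy-map : ∀ {A B : Set} (f : A → ℤ) (h : B → A) xs → sumBy f (map h xs) ≡ sumBy (f ∘ h) xs
sumBy-map f h [] = refl
sumBy-map f h (x ∷ xs) = cong (_+_ (f (h x))) (sumBy-map f h xs)

sumBy-cong : ∀ {A : Set} {f g : A → ℤ} xs → (∀ v → f v ≡ g v) → sumBy f xs ≡ sumBy g xs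
sumBy-cong [] f≗g = refl
sumBy-cong (x ∷ xs) f≗g = cong₂ _+_ (f≗g x) (sumBy-cong xs f≗g)

sumBy-+ : ∀ {A : Set} (f g : A → ℤ) xs → sumBy (λ v → f v + g v) xs ≡ sumBy f xs + sumBy g xs
sumBy-+ f g [] = refl
sumBy-+ f g (x ∷ xs) = trans (cong (_+_ (f x + g x)) (sumBy-+ f g xs))
                             (ℤ-interchange (f x) (g x) (sumBy f xs) (sumBy g xs))

sumBy-neg : ∀ {A : Set} (f : A → ℤ) xs → sumBy (λ v → - f v) xs ≡ - sumBy f xs
sumBy-neg f [] = refl
sumBy-neg f (x ∷ xs) = trans (cong (_+_ (- f x)) (sumBy-neg f xs)) (sym (ZP.neg-distrib-+ (f x) (sumBy f xs)))

sumAll-suc : ∀ {d} (f : Pt (suc d) → ℤ) → sumAll f ≡ sumAll {d} (f ∘ (true ∷_)) + sumAll {d} (f ∘ (false ∷_))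
sumAll-suc {d} f = trans (sumBy-++ f (map (true ∷_) (allPts d)) (map (false ∷_) (allPts d)))
  (cong₂ _+_ (sumBy-map f (true ∷_) (allPts d)) (sumBy-map f (false ∷_) (allPts d)))

sumAll-cong : ∀ {d} {f g : Pt d → ℤ} → (∀ v → f v ≡ g v) → sumAll f ≡ sumAll g
sumAll-cong {d} = sumBy-cong (allPts d)

sumAll-+ : ∀ {d} (f g : Pt d → ℤ) → sumAll (λ v → f v + g v) ≡ sumAll f + sumAll g
sumAll-+ {d} f g = sumBy-+ f g (allPts d)

sumAll-neg : ∀ {d} (f : Pt d → ℤ) → sumAll (λ v → - f v) ≡ - sumAll f
sumAll-neg {d} f = sumBy-neg f (allPts d)

sumAll-0 : ∀ d → sumAll {d} (λ _ → + 0) ≡ + 0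
sumAll-0 d = sumBy-0 (allPts d)
  where
  sumBy-0 : ∀ xs → sumBy {Pt d} (λ _ → + 0) xs ≡ + 0
  sumBy-0 [] = refl
  sumBy-0 (_ ∷ xs) = trans (ZP.+-identityˡ _) (sumBy-0 xs)

δ : ∀ {d} → Pt d → ℤ → Pt d → ℤ
δ p a v = if does (v ≟ₚ p) then a else + 0

δ-self : ∀ {d} (p : Pt d) a → δ p a p ≡ a
δ-self p a with p ≟ₚ p
... | yes _ = refl
... | no p≢p = ⊥-elim (p≢p refl)

δ-other : ∀ {d} (p : Pt d) a v → v ≢ p → δ p a v ≡ + 0
δ-other p a v v≢p with v ≟ₚ p
... | yes v≡p = ⊥-elim (v≢p v≡p)
... | no _ = refl

δ-* : ∀ {d} (p : Pt d) a (f : Pt d → ℤ) v → δ p a v * f v ≡ δ p (a * f p) v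
δ-* p a f v with v ≟ₚ p
... | yes refl = refl
... | no _ = ZP.*-zeroˡ (f v)

sumAll-δ : ∀ {d} (p : Pt d) a → sumAll (δ p a) ≡ a
sumAll-δ {zero} [] a = ZP.+-identityʳ a
sumAll-δ {suc d} (true ∷ p) a =
  trans (sumAll-suc (δ (true ∷ p) a)) (trans (cong₂ _+_ (sumAll-δ p a) (sumAll-0 d)) (ZP.+-identityʳ a))
sumAll-δ {suc d} (false ∷ p) a =
  trans (sumAll-suc (δ (false ∷ p) a)) (trans (cong₂ _+_ (sumAll-0 d) (sumAll-δ p a)) (ZP.+-identityˡ a))

sumAll-δ-* : ∀ {d} (p : Pt d) a (f : Pt d → ℤ) → sumAll (λ v → δ p a v * f v) ≡ a * f p
sumAll-δ-* p a f = trans (sumAll-cong (δ-* p a f)) (sumAll-δ p (a * f p))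

sumFin : ∀ {k} → (Fin k → ℤ) → ℤ
sumFin {zero} f = + 0
sumFin {suc k} f = f zero + sumFin (f ∘ suc)

sumFin-*ˡ : ∀ {k} a (f : Fin k → ℤ) → a * sumFin f ≡ sumFin (λ i → a * f i)
sumFin-*ˡ {zero} a f = ZP.*-zeroʳ a
sumFin-*ˡ {suc k} a f = trans (ZP.*-distribˡ-+ a (f zero) _) (cong (_+_ (a * f zero)) (sumFin-*ˡ a (f ∘ suc)))

sumAll-sumFin : ∀ {d k} (F : Pt d → Fin k → ℤ) →
                sumAll (λ w → sumFin (F w)) ≡ sumFin (λ i → sumAll (λ w → F w i))
sumAll-sumFin {d} {zero} F = sumAll-0 d
sumAll-sumFin {d} {suc k} F = trans (sumAll-+ (λ w → F w zero) (λ w → sumFin (F w ∘ suc)))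
  (cong (_+_ (sumAll (λ w → F w zero))) (sumAll-sumFin (λ w → F w ∘ suc)))

sumFin-0 : ∀ {k} (f : Fin k → ℤ) → (∀ i → f i ≡ + 0) → sumFin f ≡ + 0
sumFin-0 {zero} f zeros = refl
sumFin-0 {suc k} f zeros = cong₂ _+_ (zeros zero) (sumFin-0 (f ∘ suc) (zeros ∘ suc))

dist-sumFin : ∀ {d} (u w : Pt d) → + dist u w ≡ sumFin (λ i → + bit (lookup u i xor lookup w i))
dist-sumFin [] [] = refl
dist-sumFin (a ∷ u) (b ∷ w) = trans (ZP.pos-+ (bit (a xor b)) (dist u w)) (cong (_+_ (+ bit (a xor b))) (dist-sumFin u w))

-- An affine dependency annihilates every affine function of the point;
-- the functions used here are the coordinate distances w ↦ [b ≠ w i].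
module _ {d} (λ′ : Pt d → ℤ) (sum≡0 : sumAll λ′ ≡ + 0)
         (coords≡0 : ∀ i → sumAll (λ v → λ′ v * coord (lookup v i)) ≡ + 0) where

  dependency-bit : ∀ b i → sumAll (λ w → λ′ w * + bit (b xor lookup w i)) ≡ + 0
  dependency-bit false i = trans (sumAll-cong (λ w → cong (λ t → λ′ w * t) (bit≡coord (lookup w i)))) (coords≡0 i)
    where
    bit≡coord : ∀ c → + bit c ≡ coord c
    bit≡coord true = refl
    bit≡coord false = refl
  dependency-bit true i = begin
    sumAll (λ w → λ′ w * + bit (not (lookup w i)))                 ≡⟨ sumAll-cong (λ w → complement (λ′ w) (lookup w i)) ⟩
    sumAll (λ w → λ′ w + - (λ′ w * coord (lookup w i)))            ≡⟨ sumAll-+ λ′ (λ w → - (λ′ w * coord (lookup w i))) ⟩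
    sumAll λ′ + sumAll (λ w → - (λ′ w * coord (lookup w i)))       ≡⟨ cong₂ _+_ sum≡0 (sumAll-neg (λ w → λ′ w * coord (lookup w i))) ⟩
    + 0 + - sumAll (λ w → λ′ w * coord (lookup w i))               ≡⟨ cong (λ t → + 0 + - t) (coords≡0 i) ⟩
    + 0                                                            ∎
    where
    open ≡-Reasoning
    complement : ∀ a c → a * + bit (not c) ≡ a + - (a * coord c)
    complement a true = trans (ZP.*-zeroʳ a) (sym (trans (cong (λ t → a + - t) (ZP.*-identityʳ a)) (ZP.+-inverseʳ a)))
    complement a false = trans (ZP.*-identityʳ a) (sym (trans (cong (λ t → a + - t) (ZP.*-zeroʳ a)) (ZP.+-identityʳ a)))

  dependency-dist : ∀ u → sumAll (λ w → λ′ w * + dist u w) ≡ + 0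
  dependency-dist u = begin
    sumAll (λ w → λ′ w * + dist u w)           ≡⟨ sumAll-cong expand ⟩
    sumAll (λ w → sumFin (λ i → term i w))    ≡⟨ sumAll-sumFin (λ w i → term i w) ⟩
    sumFin (λ i → sumAll (term i))            ≡⟨ sumFin-0 _ (λ i → dependency-bit (lookup u i) i) ⟩
    + 0                                       ∎
    where
    open ≡-Reasoning
    bits : Pt d → Fin d → ℤ
    bits w i = + bit (lookup u i xor lookup w i)
    term : Fin d → Pt d → ℤ
    term i w = λ′ w * bits w i
    expand : ∀ w → λ′ w * + dist u w ≡ sumFin (λ i → term i w)
    expand w = trans (cong (λ′ w *_) (dist-sumFin u w)) (sumFin-*ˡ (λ′ w) (bits w))

IsSimplex-resp-≈ : ∀ {d} {F G : VSet d} → F ≈ G → IsSimplex F → IsSimplex G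
IsSimplex-resp-≈ (_ , G⊆F) sF λ′ supp = sF λ′ (λ v ¬fv → supp v (¬fv ∘ G⊆F v))

Corner-isSimplex : ∀ {d} (σ : Pattern d) u → IsSimplex (Corner σ u)
Corner-isSimplex σ u λ′ supp sum≡0 coords≡0 v with Corner? σ u v
... | no ¬cv = supp v ¬cv
... | yes cv with l , refl ← dist≡1⇒toggle u v (proj₂ cv) = begin
  λ′ p                                                   ≡⟨ sumAll-δ p (λ′ p) ⟨
  sumAll (δ p (λ′ p))                                    ≡⟨ sumAll-cong pointwise ⟨
  sumAll (λ w → λ′ w * + bit (lookup u l xor lookup w l)) ≡⟨ dependency-bit λ′ sum≡0 coords≡0 (lookup u l) l ⟩
  + 0                                                    ∎
  where
  open ≡-Reasoning
  p = toggle u l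
  pointwise : ∀ w → λ′ w * + bit (lookup u l xor lookup w l) ≡ δ p (λ′ p) w
  pointwise w with w ≟ₚ p
  ... | yes refl rewrite lookup-toggle-same u l | BP.xor-inverseʳ (lookup u l) = ZP.*-identityʳ (λ′ p)
  ... | no w≢p with Corner? σ u w
  ...   | yes cw rewrite Corner-lookup u w l (proj₂ cw) w≢p | BP.xor-same (lookup u l) = ZP.*-zeroʳ (λ′ w)
  ...   | no ¬cw rewrite supp w ¬cw = refl

-- Against the distance to u, an affine dependency on Corner σ u ∪ {v} weighs
-- every corner point with 1 and v with dist u v, which forces λ′ v = 0.
Corner∪-isSimplex : ∀ {d} (σ : Pattern d) u v → dist u v ≢ 1 → IsSimplex (Corner σ u ∪₁ v)
Corner∪-isSimplex σ u v d≢1 λ′ supp sum≡0 coords≡0 = Corner-isSimplex σ u λ′ suppC sum≡0 coords≡0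
  where
  n = + dist u v
  outside : ∀ {w} → ¬ Corner σ u w → w ≢ v → ¬ (Corner σ u ∪₁ v) w
  outside ¬cw w≢v (inj₁ cw) = ¬cw cw
  outside ¬cw w≢v (inj₂ w≡v) = w≢v w≡v
  pointwise : ∀ w → λ′ w * + dist u w ≡ λ′ w + δ v (λ′ v * (n - + 1)) w
  pointwise w with w ≟ₚ v
  ... | yes refl = expand (λ′ v) n
    where
    expand : ∀ a n → a * n ≡ a + a * (n - + 1)
    expand = solve-∀
  ... | no w≢v with Corner? σ u w
  ...   | yes cw rewrite proj₂ cw = trans (ZP.*-identityʳ (λ′ w)) (sym (ZP.+-identityʳ (λ′ w)))
  ...   | no ¬cw rewrite supp w (outside ¬cw w≢v) = refl
  scaled≡0 : λ′ v * (n - + 1) ≡ + 0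
  scaled≡0 = begin
    λ′ v * (n - + 1)                                  ≡⟨ ZP.+-identityˡ _ ⟨
    + 0 + λ′ v * (n - + 1)                            ≡⟨ cong₂ _+_ sum≡0 (sumAll-δ v _) ⟨
    sumAll λ′ + sumAll (δ v (λ′ v * (n - + 1)))       ≡⟨ sumAll-+ λ′ _ ⟨
    sumAll (λ w → λ′ w + δ v (λ′ v * (n - + 1)) w)    ≡⟨ sumAll-cong pointwise ⟨
    sumAll (λ w → λ′ w * + dist u w)                  ≡⟨ dependency-dist λ′ sum≡0 coords≡0 u ⟩
    + 0                                               ∎
    where open ≡-Reasoning
  λ′v≡0 : λ′ v ≡ + 0
  λ′v≡0 with ZP.i*j≡0⇒i≡0∨j≡0 (λ′ v) scaled≡0
  ... | inj₁ λ′v≡0 = λ′v≡0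
  ... | inj₂ n-1≡0 = ⊥-elim (d≢1 (ZP.+-injective (ZP.i-j≡0⇒i≡j n (+ 1) n-1≡0)))
  suppC : ∀ w → ¬ Corner σ u w → λ′ w ≡ + 0
  suppC w ¬cw with w ≟ₚ v
  ... | yes refl = λ′v≡0
  ... | no w≢v = supp w (outside ¬cw w≢v)

parallelogram : ∀ {d} → Pt d → Pt d → Pt d → Pt d → Pt d → ℤ
parallelogram x y₁ y₂ y₃ w = (δ x (+ 1) w + δ y₃ (+ 1) w) + - (δ y₁ (+ 1) w + δ y₂ (+ 1) w)

sumAll-parallelogram : ∀ {d} (x y₁ y₂ y₃ : Pt d) (f : Pt d → ℤ) →
                       sumAll (λ w → parallelogram x y₁ y₂ y₃ w * f w) ≡ (f x + f y₃) + - (f y₁ + f y₂)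
sumAll-parallelogram x y₁ y₂ y₃ f = begin
  sumAll (λ w → parallelogram x y₁ y₂ y₃ w * f w)              ≡⟨ sumAll-cong pointwise ⟩
  sumAll (λ w → (X w + Y₃ w) + - (Y₁ w + Y₂ w))                ≡⟨ sumAll-+ (λ w → X w + Y₃ w) (λ w → - (Y₁ w + Y₂ w)) ⟩
  sumAll (λ w → X w + Y₃ w) + sumAll (λ w → - (Y₁ w + Y₂ w))   ≡⟨ cong₂ _+_ (sumAll-+ X Y₃) neg ⟩
  (sumAll X + sumAll Y₃) + - (sumAll Y₁ + sumAll Y₂)
    ≡⟨ cong₂ (λ s t → s + - t) (cong₂ _+_ (at x) (at y₃)) (cong₂ _+_ (at y₁) (at y₂)) ⟩
  (f x + f y₃) + - (f y₁ + f y₂)                               ∎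
  where
  open ≡-Reasoning
  X = λ w → δ x (+ 1) w * f w
  Y₁ = λ w → δ y₁ (+ 1) w * f w
  Y₂ = λ w → δ y₂ (+ 1) w * f w
  Y₃ = λ w → δ y₃ (+ 1) w * f w
  distrib : ∀ a b c e t → ((a + b) + - (c + e)) * t ≡ (a * t + b * t) + - (c * t + e * t)
  distrib = solve-∀
  pointwise : ∀ w → parallelogram x y₁ y₂ y₃ w * f w ≡ (X w + Y₃ w) + - (Y₁ w + Y₂ w)
  pointwise w = distrib (δ x (+ 1) w) (δ y₃ (+ 1) w) (δ y₁ (+ 1) w) (δ y₂ (+ 1) w) (f w)
  neg : sumAll (λ w → - (Y₁ w + Y₂ w)) ≡ - (sumAll Y₁ + sumAll Y₂)
  neg = trans (sumAll-neg (λ w → Y₁ w + Y₂ w)) (cong -_ (sumAll-+ Y₁ Y₂))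
  at : ∀ p → sumAll (λ w → δ p (+ 1) w * f w) ≡ f p
  at p = trans (sumAll-δ-* p (+ 1) f) (ZP.*-identityˡ (f p))

parallelogram⇒¬IsSimplex : ∀ {d} {F : VSet d} x y₁ y₂ y₃ → F x → F y₁ → F y₂ → F y₃ →
  x ≢ y₁ → x ≢ y₂ → x ≢ y₃ →
  (∀ i → coord (lookup x i) + coord (lookup y₃ i) ≡ coord (lookup y₁ i) + coord (lookup y₂ i)) →
  ¬ IsSimplex F
parallelogram⇒¬IsSimplex {d} {F} x y₁ y₂ y₃ fx fy₁ fy₂ fy₃ x≢y₁ x≢y₂ x≢y₃ parallel isSimplex =
  1≢0 (trans (sym λ′x≡1) (isSimplex λ′ supp sum≡0 coords≡0 x))
  where
  λ′ = parallelogram x y₁ y₂ y₃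
  1≢0 : + 1 ≢ + 0
  1≢0 ()
  sum≡0 : sumAll λ′ ≡ + 0
  sum≡0 = trans (sumAll-cong (λ w → sym (ZP.*-identityʳ (λ′ w)))) (sumAll-parallelogram x y₁ y₂ y₃ (λ _ → + 1))
  coords≡0 : ∀ i → sumAll (λ w → λ′ w * coord (lookup w i)) ≡ + 0
  coords≡0 i = trans (sumAll-parallelogram x y₁ y₂ y₃ (λ w → coord (lookup w i)))
    (trans (cong (_+ - pair) (parallel i)) (ZP.+-inverseʳ pair))
    where pair = coord (lookup y₁ i) + coord (lookup y₂ i)
  supp : ∀ w → ¬ F w → λ′ w ≡ + 0
  supp w ¬fw = cong₂ (λ s t → s + - t)
    (cong₂ _+_ (δ-other x (+ 1) w (¬fw ∘ λ { refl → fx })) (δ-other y₃ (+ 1) w (¬fw ∘ λ { refl → fy₃ })))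
    (cong₂ _+_ (δ-other y₁ (+ 1) w (¬fw ∘ λ { refl → fy₁ })) (δ-other y₂ (+ 1) w (¬fw ∘ λ { refl → fy₂ })))
  λ′x≡1 : λ′ x ≡ + 1
  λ′x≡1 = cong₂ (λ s t → s + - t)
    (cong₂ _+_ (δ-self x (+ 1)) (δ-other y₃ (+ 1) x x≢y₃))
    (cong₂ _+_ (δ-other y₁ (+ 1) x x≢y₁) (δ-other y₂ (+ 1) x x≢y₂))

Half-notSimplex : ∀ {d} (σ : Pattern d) → 4 N.≤ #free σ → ¬ IsSimplex (Half σ)
Half-notSimplex σ h4
  with a , fa , [] ← freeOutside σ [] (NP.<⇒≤ (NP.<⇒≤ (NP.<⇒≤ h4)))
  with b , fb , b≢a ∷ [] ← freeOutside σ (a ∷ []) (NP.<⇒≤ (NP.<⇒≤ h4))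
  with c , fc , c≢a ∷ c≢b ∷ [] ← freeOutside σ (a ∷ b ∷ []) (NP.<⇒≤ h4)
  with e , fe , e≢a ∷ e≢b ∷ e≢c ∷ [] ← freeOutside σ (a ∷ b ∷ c ∷ []) h4
  with x , hx ← Half-nonempty σ (NP.<⇒≤ (NP.<⇒≤ (NP.<⇒≤ h4)))
  = parallelogram⇒¬IsSimplex x y₁ y₂ y₃ hx hy₁
      (Half-toggle₂ σ x c e fc fe hx) (Half-toggle₂ σ y₁ c e fc fe hy₁)
      (toggle₂≢ x a b b≢a ∘ sym) (toggle₂≢ x c e e≢c ∘ sym) x≢y₃ parallel
  where
  y₁ = toggle₂ x a b
  y₂ = toggle₂ x c e
  y₃ = toggle₂ y₁ c e
  hy₁ = Half-toggle₂ σ x a b fa fb hx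
  x≢y₃ : x ≢ y₃
  x≢y₃ x≡y₃ = not≢self (lookup x a) (begin
    not (lookup x a)    ≡⟨ lookup-toggle₂-first x a b b≢a ⟨
    lookup y₁ a         ≡⟨ lookup-toggle₂-other y₁ c e a (c≢a ∘ sym) (e≢a ∘ sym) ⟨
    lookup y₃ a         ≡⟨ cong (λ z → lookup z a) x≡y₃ ⟨
    lookup x a          ∎)
    where open ≡-Reasoning
  flips : ∀ (z : Pt _) j l i → lookup (toggle₂ z j l) i ≡ lookup z i xor (does (i FP.≟ j) xor does (i FP.≟ l))
  flips z j l i = trans (lookup-toggle-xor (toggle z j) l i)
    (trans (cong (_xor does (i FP.≟ l)) (lookup-toggle-xor z j i)) (BP.xor-assoc (lookup z i) _ _))
  parallel : ∀ i → coord (lookup x i) + coord (lookup y₃ i) ≡ coord (lookup y₁ i) + coord (lookup y₂ i)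
  parallel i rewrite flips y₁ c e i | flips x a b i | flips x c e i with i FP.≟ c | i FP.≟ e
  ... | no _ | no _ rewrite BP.xor-identityʳ (lookup x i xor (does (i FP.≟ a) xor does (i FP.≟ b)))
                          | BP.xor-identityʳ (lookup x i) = ZP.+-comm (coord (lookup x i)) _
  ... | yes refl | _ rewrite dec-false (i FP.≟ a) c≢a | dec-false (i FP.≟ b) c≢b | BP.xor-identityʳ (lookup x i) = refl
  ... | no _ | yes refl rewrite dec-false (i FP.≟ a) e≢a | dec-false (i FP.≟ b) e≢b | BP.xor-identityʳ (lookup x i) = refl

-- The pulling triangulation

∪₁-cong : ∀ {d} {A B : VSet d} (v : Pt d) → A ≈ B → (A ∪₁ v) ≈ (B ∪₁ v)
∪₁-cong v (A⊆B , B⊆A) = (λ { w (inj₁ a) → inj₁ (A⊆B w a) ; w (inj₂ e) → inj₂ e })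
                      , (λ { w (inj₁ b) → inj₁ (B⊆A w b) ; w (inj₂ e) → inj₂ e })

Minimal-resp-≈ : ∀ {d} {_⪯_ : Pt d → Pt d → Set} {F G : VSet d} {v} →
                 F ≈ G → Minimal _⪯_ F v → Minimal _⪯_ G v
Minimal-resp-≈ (F⊆G , G⊆F) (fv , min) = F⊆G _ fv , λ w gw → min w (G⊆F w gw)

IsFacetOf-resp-≈ : ∀ {d} {G F F′ : VSet d} → F ≈ F′ → IsFacetOf G F → IsFacetOf G F′
IsFacetOf-resp-≈ F≈F′@(F⊆F′ , F′⊆F) (fG , G⊆F , (y , fy , ¬gy) , maximal) =
  fG , (λ v → F⊆F′ v ∘ G⊆F v) , (y , F⊆F′ y fy , ¬gy) ,
  λ K fK G⊆K K⊆F′ → Data.Sum.map₂ (λ K≈F → ≈-trans K≈F F≈F′)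
                                   (maximal K fK G⊆K (λ v → F′⊆F v ∘ K⊆F′ v))

Pull-resp-≈ : ∀ {d} {_⪯_ : Pt d → Pt d → Set} {F F′ S : VSet d} →
              F ≈ F′ → Pull _⪯_ F S → Pull _⪯_ F′ S
Pull-resp-≈ F≈F′ (simplex sF S≈F) = simplex (IsSimplex-resp-≈ F≈F′ sF) (≈-trans S≈F F≈F′)
Pull-resp-≈ {_⪯_ = _⪯_} F≈F′ (pull v ¬sF min facet ¬gv pG S≈) =
  pull v (¬sF ∘ IsSimplex-resp-≈ (≈-sym F≈F′)) (Minimal-resp-≈ {_⪯_ = _⪯_} F≈F′ min)
         (IsFacetOf-resp-≈ F≈F′ facet) ¬gv pG S≈

Pull-ofSimplex : ∀ {d} {_⪯_ : Pt d → Pt d → Set} {F S : VSet d} → IsSimplex F → Pull _⪯_ F S → S ≈ F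
Pull-ofSimplex sF (simplex _ S≈F) = S≈F
Pull-ofSimplex sF (pull _ ¬sF _ _ _ _ _) = ⊥-elim (¬sF sF)

module Pulling {d : ℕ} (_⪯_ : Pt d → Pt d → Set) (uniqueMinima : UniqueMinima _⪯_) where

  -- The minimal vertex of Half σ; the junk value basePoint σ is never used,
  -- since Half σ is nonempty whenever σ has a free coordinate.
  minVertex : Pattern d → Pt d
  minVertex σ with ∃Pt? d (Half σ) (Half? σ)
  ... | yes nonempty = proj₁ (uniqueMinima (Half σ) (Half-isFace σ) nonempty)
  ... | no _ = basePoint σ

  minVertex-minimal : ∀ σ → Σ (Pt d) (Half σ) → Minimal _⪯_ (Half σ) (minVertex σ)
  minVertex-minimal σ x with ∃Pt? d (Half σ) (Half? σ)
  ... | yes nonempty = proj₁ (proj₂ (uniqueMinima (Half σ) (Half-isFace σ) nonempty))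
  ... | no empty = ⊥-elim (empty x)

  minVertex-unique : ∀ σ w → Minimal _⪯_ (Half σ) w → w ≡ minVertex σ
  minVertex-unique σ w min with ∃Pt? d (Half σ) (Half? σ)
  ... | yes nonempty = proj₂ (proj₂ (uniqueMinima (Half σ) (Half-isFace σ) nonempty)) w min
  ... | no empty = ⊥-elim (empty (w , proj₁ min))

  minVertex∈Half : ∀ σ → 1 N.≤ #free σ → Half σ (minVertex σ)
  minVertex∈Half σ h = proj₁ (minVertex-minimal σ (Half-nonempty σ h))

  -- Half (step σ i) is the coordinate facet of Half σ opposite to its minimal vertex.
  step : Pattern d → Fin d → Pattern d
  step σ i = fix σ i (not (lookup (minVertex σ) i))

  simplexOf : Pattern d → List (Fin d) → Subset d → VSet d
  simplexOf σ [] B = Corner σ (minVertex σ ⊕ B) ∪₁ minVertex σ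
  simplexOf σ (i ∷ τ) B = simplexOf (step σ i) τ B ∪₁ minVertex σ

  record Admissible (σ : Pattern d) (τ : List (Fin d)) (B : Subset d) : Set where
    field
      τ-free : ∀ i → i ∈L τ → Free σ i
      τ-unique : Unique τ
      τ-disjoint : ∀ i → i ∈L τ → i ∉S B
      B-free : ∀ i → lookup B i ≡ true → Free σ i
      B-isOdd : Odd ∣ B ∣
      B-≢1 : ∣ B ∣ ≢ 1
  open Admissible

  Admissible⇒#free≥3 : ∀ {σ τ B} → Admissible σ τ B → 3 N.≤ #free σ
  Admissible⇒#free≥3 {σ} {B = B} adm = NP.≤-trans
    (subst (3 N.≤_) (∣∣≡weight B) (odd≢1⇒≥3 ∣ B ∣ (B-isOdd adm) (B-≢1 adm))) (weight≤#free σ B (B-free adm))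

  Admissible-step : ∀ {σ i τ B} → Admissible σ (i ∷ τ) B → Admissible (step σ i) τ B
  Admissible-step {σ} {i} {τ} {B} adm with i∉τ ∷ unique ← τ-unique adm = record
    { τ-free = λ j j∈τ → Free-fix⁺ σ i _ j (≢i j∈τ) (τ-free adm j (there j∈τ))
    ; τ-unique = unique
    ; τ-disjoint = λ j → τ-disjoint adm j ∘ there
    ; B-free = λ j Bj → Free-fix⁺ σ i _ j (i∉B ∘ Bj≡true j Bj) (B-free adm j Bj)
    ; B-isOdd = B-isOdd adm
    ; B-≢1 = B-≢1 adm }
    where
    ≢i : ∀ {j} → j ∈L τ → j ≢ i
    ≢i j∈τ j≡i = All.lookup i∉τ j∈τ (sym j≡i)
    i∉B : i ∉S B
    i∉B = τ-disjoint adm i (here refl)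
    Bj≡true : ∀ j → lookup B j ≡ true → j ≡ i → i ∈S B
    Bj≡true j Bj refl = VP.lookup⇒[]= j B Bj

  Admissible-step⁻ : ∀ {σ j τ B} → Free σ j → Admissible (step σ j) τ B → Admissible σ (j ∷ τ) B
  Admissible-step⁻ {σ} {j} {τ} {B} fj adm = record
    { τ-free = λ { i (here refl) → fj ; i (there i∈τ) → proj₂ (Free-fix⁻ σ j _ i (τ-free adm i i∈τ)) }
    ; τ-unique = All.tabulate (λ i∈τ j≡i → proj₁ (Free-fix⁻ σ j _ _ (τ-free adm _ i∈τ)) (sym j≡i))
                 ∷ τ-unique adm
    ; τ-disjoint = λ { i (here refl) j∈B → fixed (B-free adm j (VP.[]=⇒lookup j∈B))
                     ; i (there i∈τ) → τ-disjoint adm i i∈τ }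
    ; B-free = λ i Bi → proj₂ (Free-fix⁻ σ j _ i (B-free adm i Bi))
    ; B-isOdd = B-isOdd adm
    ; B-≢1 = B-≢1 adm }
    where
    fixed : ¬ Free (step σ j) j
    fixed fr with () ← trans (sym (lookup-fix-same σ j _)) fr

  #free-step : ∀ {σ i τ B} → Admissible σ (i ∷ τ) B → 4 N.≤ #free σ
  #free-step {σ} {i} adm = subst (4 N.≤_) (#free-fix σ i _ (τ-free adm i (here refl)))
                                 (s≤s (Admissible⇒#free≥3 (Admissible-step adm)))

  minVertex∉step : ∀ σ i → Free σ i → ¬ Half (step σ i) (minVertex σ)
  minVertex∉step σ i fi (_ , m) =
    not≢self (lookup (minVertex σ) i) (sym (proj₂ (Matches-fix⁻ σ i _ (minVertex σ) fi m)))

  module Centre {σ τ B} (adm : Admissible σ τ B) where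

    v = minVertex σ
    u = v ⊕ B

    hv : Half σ v
    hv = minVertex∈Half σ (NP.<⇒≤ (NP.<⇒≤ (Admissible⇒#free≥3 adm)))

    mu : Matches σ u
    mu = Matches-⊕ σ v B (proj₂ hv) (B-free adm)

    odd : parity u ≡ true
    odd = trans (parity-⊕ v B) (cong₂ _xor_ (HVert⇒even v (proj₁ hv))
                (subst (λ n → oddᵇ n ≡ true) (∣∣≡weight B) (Odd⇒oddᵇ ∣ B ∣ (B-isOdd adm))))

    dist-u-v : dist u v ≡ ∣ B ∣
    dist-u-v = trans (dist-sym u v) (trans (dist-⊕ v B) (sym (∣∣≡weight B)))

    v∉Corner : ¬ Corner σ u v
    v∉Corner c = B-≢1 adm (trans (sym dist-u-v) (proj₂ c))

    Half₃≈ : #free σ ≡ 3 → (Corner σ u ∪₁ v) ≈ Half σ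
    Half₃≈ n≡3 = (λ { w (inj₁ c) → proj₁ c ; w (inj₂ refl) → hv })
               , Half₃-cover σ n≡3 v u hv mu odd (trans dist-u-v |B|≡3)
      where
      |B|≡3 : ∣ B ∣ ≡ 3
      |B|≡3 = NP.≤-antisym
        (subst (N._≤ 3) (sym (∣∣≡weight B)) (subst (weight B N.≤_) n≡3 (weight≤#free σ B (B-free adm))))
                           (odd≢1⇒≥3 ∣ B ∣ (B-isOdd adm) (B-≢1 adm))

    corner-avoids : ∀ i → Free σ i → ∀ b → ∃ λ x → Corner σ u x × lookup x i ≢ b
    corner-avoids = Corner-avoids σ u mu odd (NP.<⇒≤ (Admissible⇒#free≥3 adm))

    Half₃-isSimplex : #free σ ≡ 3 → IsSimplex (Half σ)
    Half₃-isSimplex n≡3 = IsSimplex-resp-≈ (Half₃≈ n≡3) (Corner∪-isSimplex σ u v (v∉Corner ∘ (hv ,_)))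

  Admissible-freeSet : ∀ σ → #free σ ≡ 3 → Admissible σ [] (freeSet σ)
  Admissible-freeSet σ n≡3 = record
    { τ-free = λ _ () ; τ-unique = [] ; τ-disjoint = λ _ ()
    ; B-free = freeSet-free σ
    ; B-isOdd = subst Odd (sym |B|≡3) refl
    ; B-≢1 = λ |B|≡1 → 3≢1 (trans (sym |B|≡3) |B|≡1) }
    where
    |B|≡3 : ∣ freeSet σ ∣ ≡ 3
    |B|≡3 = trans (∣∣≡weight (freeSet σ)) (trans (weight-freeSet σ) n≡3)
    3≢1 : 3 ≢ 1
    3≢1 ()

  Admissible-corner : ∀ σ u → Half σ (minVertex σ) → Matches σ u → parity u ≡ true →
                      ¬ Corner σ u (minVertex σ) →
                      Admissible σ [] (minVertex σ ⊕ u)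
  Admissible-corner σ u hv mu odd v∉C = record
    { τ-free = λ _ () ; τ-unique = [] ; τ-disjoint = λ _ ()
    ; B-free = λ i Bi → Differ⇒Free σ v u i (proj₂ hv) mu (trans (sym (lookup-⊕ v u i)) Bi)
    ; B-isOdd = oddᵇ⇒Odd ∣ B₀ ∣
        (trans (cong oddᵇ (trans |B₀|≡dist (dist-sym v u))) (dist-odd u v odd (proj₁ hv)))
    ; B-≢1 = λ |B₀|≡1 → v∉C (hv , trans (dist-sym u v) (trans (sym |B₀|≡dist) |B₀|≡1)) }
    where
    v = minVertex σ
    B₀ = v ⊕ u
    |B₀|≡dist : ∣ B₀ ∣ ≡ dist v u
    |B₀|≡dist = trans (∣∣≡weight B₀) (trans (sym (dist-⊕ v B₀)) (cong (dist v) (⊕-cancel v u)))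

  simplexOf-∈Pull : ∀ σ τ B → Admissible σ τ B → Pull _⪯_ (Half σ) (simplexOf σ τ B)
  simplexOf-∈Pull σ (i ∷ τ) B adm =
    pull (minVertex σ) (Half-notSimplex σ h4) (minVertex-minimal σ (Half-nonempty σ (NP.<⇒≤ (NP.<⇒≤ (NP.<⇒≤ h4)))))
         (fix-isFacet σ i _ fi h4) (minVertex∉step σ i fi) (simplexOf-∈Pull (step σ i) τ B (Admissible-step adm)) ≈-refl
    where
    fi = τ-free adm i (here refl)
    h4 = #free-step adm
  simplexOf-∈Pull σ [] B adm with NP.m≤n⇒m<n∨m≡n (Admissible⇒#free≥3 adm)
  ... | inj₁ h4 = pull v (Half-notSimplex σ h4) (minVertex-minimal σ (v , hv))
                       (Corner-isFacet σ u mu odd (Admissible⇒#free≥3 adm)) v∉Corner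
                       (simplex (Corner-isSimplex σ u) ≈-refl) ≈-refl
    where open Centre adm
  ... | inj₂ 3≡n = simplex (Half₃-isSimplex (sym 3≡n)) (Half₃≈ (sym 3≡n))
    where open Centre adm

  Decomposition : Pattern d → VSet d → Set
  Decomposition σ S = ∃₂ λ τ B → Admissible σ τ B × S ≈ simplexOf σ τ B

  -- Pulling Half σ from its minimal vertex v recurses into the facets not containing v:
  -- a coordinate facet prolongs τ, a corner facet (a simplex) ends the recursion with B = v ⊕ u.
  Pull⇒simplexOf : ∀ σ → 3 N.≤ #free σ → ∀ {F S} → Pull _⪯_ F S → F ≈ Half σ → Decomposition σ S
  Pull⇒simplexOf σ h3 (simplex sF S≈F) F≈H with NP.m≤n⇒m<n∨m≡n h3
  ... | inj₁ h4 = ⊥-elim (Half-notSimplex σ h4 (IsSimplex-resp-≈ F≈H sF))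
  ... | inj₂ 3≡n = [] , freeSet σ , adm , ≈-trans S≈F (≈-trans F≈H (≈-sym (Centre.Half₃≈ adm (sym 3≡n))))
    where adm = Admissible-freeSet σ (sym 3≡n)
  Pull⇒simplexOf σ h3 (pull {G = G} {Q = Q} v ¬sF min facet ¬gv pQ S≈) F≈H with NP.m≤n⇒m<n∨m≡n h3
  ... | inj₂ 3≡n = ⊥-elim (¬sF (IsSimplex-resp-≈ (≈-sym F≈H)
                     (Centre.Half₃-isSimplex (Admissible-freeSet σ (sym 3≡n)) (sym 3≡n))))
  ... | inj₁ h4 with refl ← minVertex-unique σ v (Minimal-resp-≈ {_⪯_ = _⪯_} F≈H min)
    = byShape (facet-classification σ G h3 (IsFacetOf-resp-≈ F≈H facet))
    where
    hv = proj₁ F≈H v (proj₁ min)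
    byShape : FacetShape σ G → Decomposition σ _
    byShape (inj₁ (j , b , fj , G≈)) = prolong (Pull⇒simplexOf (step σ j) h3′ pQ G≈step)
      where
      prolong : Decomposition (step σ j) Q → Decomposition σ _
      prolong (τ′ , B , adm , Q≈) = j ∷ τ′ , B , Admissible-step⁻ fj adm , ≈-trans S≈ (∪₁-cong v Q≈)
      b≡ : b ≡ not (lookup v j)
      b≡ = ≢⇒≡not b (lookup v j) λ b≡vj →
        ¬gv (proj₂ G≈ v (proj₁ hv , Matches-fix⁺ σ j b v (proj₂ hv) (sym b≡vj)))
      G≈step : G ≈ Half (step σ j)
      G≈step = subst (λ b → G ≈ Half (fix σ j b)) b≡ G≈
      h3′ : 3 N.≤ #free (step σ j)
      h3′ = NP.≤-pred (subst (4 N.≤_) (sym (#free-fix σ j _ fj)) h4)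
    byShape (inj₂ (u , mu , odd , G≈C)) =
      [] , v ⊕ u , Admissible-corner σ u hv mu odd (¬gv ∘ proj₂ G≈C v) ,
      ≈-trans S≈ (∪₁-cong v (≈-trans Q≈G (subst (λ z → G ≈ Corner σ z) (sym (⊕-cancel v u)) G≈C)))
      where
      Q≈G : Q ≈ G
      Q≈G = Pull-ofSimplex (IsSimplex-resp-≈ (≈-sym G≈C) (Corner-isSimplex σ u)) pQ

  simplexOf⊆Half : ∀ σ τ B → Admissible σ τ B → simplexOf σ τ B ⊆ Half σ
  simplexOf⊆Half σ [] B adm w (inj₁ c) = proj₁ c
  simplexOf⊆Half σ [] B adm w (inj₂ refl) = Centre.hv adm
  simplexOf⊆Half σ (i ∷ τ) B adm w (inj₁ sw) =
    fix⊆Half σ i _ (τ-free adm i (here refl)) w (simplexOf⊆Half (step σ i) τ B (Admissible-step adm) w sw)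
  simplexOf⊆Half σ (i ∷ τ) B adm w (inj₂ refl) = Centre.hv adm

  minVertex∈simplexOf : ∀ σ τ B → simplexOf σ τ B (minVertex σ)
  minVertex∈simplexOf σ [] B = inj₂ refl
  minVertex∈simplexOf σ (i ∷ τ) B = inj₂ refl

  simplexOf-step-lookup : ∀ σ i τ B → Admissible σ (i ∷ τ) B →
                          ∀ x → simplexOf (step σ i) τ B x → lookup x i ≡ not (lookup (minVertex σ) i)
  simplexOf-step-lookup σ i τ B adm x sx = proj₂ (Matches-fix⁻ σ i _ x (τ-free adm i (here refl))
    (proj₂ (simplexOf⊆Half (step σ i) τ B (Admissible-step adm) x sx)))

  simplexOf-avoids : ∀ σ τ B → Admissible σ τ B → ∀ i → Free σ i → ∀ b →
                     ∃ λ x → simplexOf σ τ B x × lookup x i ≢ b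
  simplexOf-avoids σ [] B adm i fi b
    with x , cx , xi≢b ← Centre.corner-avoids adm i fi b
    = x , inj₁ cx , xi≢b
  simplexOf-avoids σ (l ∷ τ) B adm i fi b with l FP.≟ i
  ... | no l≢i
    with x , sx , xi≢b ← simplexOf-avoids (step σ l) τ B (Admissible-step adm) i (Free-fix⁺ σ l _ i (l≢i ∘ sym) fi) b
    = x , inj₁ sx , xi≢b
  ... | yes refl with lookup (minVertex σ) l BP.≟ b
  ...   | no vl≢b = minVertex σ , inj₂ refl , vl≢b
  ...   | yes vl≡b = minVertex (step σ l) , inj₁ (minVertex∈simplexOf (step σ l) τ B) , λ e → not≢self b (begin
    not b                                   ≡⟨ cong not vl≡b ⟨
    not (lookup (minVertex σ) l)            ≡⟨ simplexOf-step-lookup σ l τ B adm _ (minVertex∈simplexOf (step σ l) τ B) ⟨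
    lookup (minVertex (step σ l)) l         ≡⟨ e ⟩
    b                                       ∎)
    where open ≡-Reasoning

  corner⊈step : ∀ σ B j τ′ B′ → Admissible σ [] B → Admissible σ (j ∷ τ′) B′ →
                ¬ (simplexOf σ [] B ⊆ simplexOf σ (j ∷ τ′) B′)
  corner⊈step σ B j τ′ B′ adm adm′ S⊆S′
    with x , cx , xj≢ ← Centre.corner-avoids adm j (τ-free adm′ j (here refl)) (not (lookup (minVertex σ) j))
    with S⊆S′ x (inj₁ cx)
  ... | inj₁ sx = xj≢ (simplexOf-step-lookup σ j τ′ B′ adm′ x sx)
  ... | inj₂ x≡v = Centre.v∉Corner adm (subst (Corner σ (Centre.u adm)) x≡v cx)

  -- Two corners inside one another have the same centre: for a free coordinate i
  -- where the centres differ, two other neighbours of u would both equal toggle u′ i.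
  corner-unique : ∀ σ B B′ → Admissible σ [] B → Admissible σ [] B′ →
                  simplexOf σ [] B ⊆ simplexOf σ [] B′ → B ≡ B′
  corner-unique σ B B′ adm adm′ S⊆S′ = begin
    B             ≡⟨ ⊕-cancel v B ⟨
    v ⊕ u         ≡⟨ cong (v ⊕_) (lookup-ext u C′.u same) ⟩
    v ⊕ C′.u      ≡⟨ ⊕-cancel v B′ ⟩
    B′            ∎
    where
    open ≡-Reasoning
    open Centre adm
    module C′ = Centre adm′
    h3 = Admissible⇒#free≥3 adm
    same : ∀ i → lookup u i ≡ lookup C′.u i
    same i with lookup σ i in σi
    ... | just a = trans (Matches⇒lookup σ u mu i a σi) (sym (Matches⇒lookup σ C′.u C′.mu i a σi))
    ... | nothing with lookup u i BP.≟ lookup C′.u i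
    ...   | yes ui≡ = ui≡
    ...   | no ui≢
      with k , fk , k≢i ∷ [] ← freeOutside σ (i ∷ []) (NP.<⇒≤ h3)
      with l , fl , l≢i ∷ l≢k ∷ [] ← freeOutside σ (i ∷ k ∷ []) h3
      = ⊥-elim (l≢k (sym (toggle-injectiveʳ u k l (trans (into k fk k≢i) (sym (into l fl l≢i))))))
      where
      into : ∀ k → Free σ k → k ≢ i → toggle u k ≡ toggle C′.u i
      into k fk k≢i with S⊆S′ (toggle u k) (inj₁ (toggle∈Corner σ u mu odd k fk))
      ... | inj₂ e = ⊥-elim (v∉Corner (subst (Corner σ u) e (toggle∈Corner σ u mu odd k fk)))
      ... | inj₁ c with m , e ← dist≡1⇒toggle C′.u (toggle u k) (proj₂ c) with i FP.≟ m
      ...   | yes refl = e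
      ...   | no i≢m = ⊥-elim (ui≢ (trans (sym (lookup-toggle-other u k i (k≢i ∘ sym)))
                                       (trans (cong (λ z → lookup z i) e) (lookup-toggle-other C′.u m i i≢m))))

  simplexOf-step-⊆ : ∀ {σ i τ B τ′ B′} → simplexOf σ (i ∷ τ) B ⊆ simplexOf σ (i ∷ τ′) B′ →
                     Admissible σ (i ∷ τ) B → simplexOf (step σ i) τ B ⊆ simplexOf (step σ i) τ′ B′
  simplexOf-step-⊆ {σ} {i} {τ} {B} S⊆S′ adm x sx with S⊆S′ x (inj₁ sx)
  ... | inj₁ sx′ = sx′
  ... | inj₂ refl = ⊥-elim (not≢self (lookup (minVertex σ) i) (sym (simplexOf-step-lookup σ i τ B adm _ sx)))

  simplexOf-injective : ∀ σ τ B τ′ B′ → Admissible σ τ B → Admissible σ τ′ B′ →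
                        simplexOf σ τ B ≈ simplexOf σ τ′ B′ → τ ≡ τ′ × B ≡ B′
  simplexOf-injective σ [] B [] B′ adm adm′ (S⊆S′ , _) = refl , corner-unique σ B B′ adm adm′ S⊆S′
  simplexOf-injective σ [] B (j ∷ τ′) B′ adm adm′ (S⊆S′ , _) = ⊥-elim (corner⊈step σ B j τ′ B′ adm adm′ S⊆S′)
  simplexOf-injective σ (i ∷ τ) B [] B′ adm adm′ (_ , S′⊆S) = ⊥-elim (corner⊈step σ B′ i τ B adm′ adm S′⊆S)
  simplexOf-injective σ (i ∷ τ) B (j ∷ τ′) B′ adm adm′ (S⊆S′ , S′⊆S) with i FP.≟ j
  ... | yes refl
    with τ≡τ′ , B≡B′ ← simplexOf-injective (step σ i) τ B τ′ B′ (Admissible-step adm) (Admissible-step adm′)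
                         ( simplexOf-step-⊆ {τ′ = τ′} {B′ = B′} S⊆S′ adm
                         , simplexOf-step-⊆ {τ′ = τ} {B′ = B} S′⊆S adm′)
    = cong (i ∷_) τ≡τ′ , B≡B′
  ... | no i≢j
    with x , sx , xi≢ ← simplexOf-avoids (step σ j) τ′ B′ (Admissible-step adm′) i
                          (Free-fix⁺ σ j _ i i≢j (τ-free adm i (here refl))) (not (lookup (minVertex σ) i))
    with S′⊆S x (inj₁ sx)
  ... | inj₁ sx′ = ⊥-elim (xi≢ (simplexOf-step-lookup σ i τ B adm x sx′))
  ... | inj₂ refl = ⊥-elim (not≢self (lookup (minVertex σ) j) (sym (simplexOf-step-lookup σ j τ′ B′ adm′ _ sx)))

  Admissible-TauB : (p : TauB d) → Admissible (allFree d) (τ p) (B p)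
  Admissible-TauB p = record
    { τ-free = λ i _ → VP.lookup-replicate i nothing ; τ-unique = τ-uniq p ; τ-disjoint = B-disj p
    ; B-free = λ i _ → VP.lookup-replicate i nothing ; B-isOdd = B-odd p ; B-≢1 = B-ne1 p }

  toTauB : ∀ {τ B} → Admissible (allFree d) τ B → TauB d
  toTauB {τ} {B} adm = record
    { τ = τ ; τ-uniq = τ-unique adm ; B = B ; B-disj = τ-disjoint adm ; B-odd = B-isOdd adm ; B-ne1 = B-≢1 adm }

proposition3p3 : (d : ℕ) → 3 N.≤ d →
    (_⪯_ : Pt d → Pt d → Set) → IsVertexOrder _⪯_ → UniqueMinima _⪯_ →
    Σ (TauB d → VSet d) (IsBijectionOntoPull _⪯_)
proposition3p3 d 3≤d _⪯_ _ uniqueMinima = simplexOfPair , inPull , onto , injective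
  where
  open Pulling _⪯_ uniqueMinima
  simplexOfPair : TauB d → VSet d
  simplexOfPair p = simplexOf (allFree d) (τ p) (B p)
  inPull : ∀ p → Pull _⪯_ (Halfcube d) (simplexOfPair p)
  inPull p = Pull-resp-≈ (≈-sym (Halfcube≈Half-allFree d))
                         (simplexOf-∈Pull (allFree d) (τ p) (B p) (Admissible-TauB p))
  onto : ∀ S → Pull _⪯_ (Halfcube d) S → ∃ λ p → S ≈ simplexOfPair p
  onto S pS
    with _ , _ , adm , S≈ ← Pull⇒simplexOf (allFree d) (subst (3 N.≤_) (sym (#free-allFree d)) 3≤d) pS
                                           (Halfcube≈Half-allFree d)
    = toTauB adm , S≈
  injective : ∀ p q → simplexOfPair p ≈ simplexOfPair q → τ p ≡ τ q × B p ≡ B q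
  injective p q = simplexOf-injective (allFree d) (τ p) (B p) (τ q) (B q) (Admissible-TauB p) (Admissible-TauB q)
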